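{- Let $q$ be a prime power with $4 \mid q-1$, and let $f \in \mathbb{F}_q[x]$ be irreducible of even degree $d$, so that $\mathbb{F}_{q^d} = \mathbb{F}_q[x]/\langle f\rangle$. Then the formal derivative $f'$ (i.e., its class modulo $f$) is a quadratic nonresidue in $\mathbb{F}_q[x]/\langle f\rangle$.
   Context: A quadratic nonresidue in a finite field $\mathbb{F}$ is an element $a$ such that $x^2 = a$ has no solution in $\mathbb{F}$. -}

module Defs where

open import Level using (Level; _⊔_)
open import Data.Nat using (ℕ; zero; suc; _<_; _≤_; _^_)
open import Data.Nat.Primality using (Prime)
open import Data.Fin using (Fin)
open import Data.List using (List; []; _∷_)
open import Data.Product using (Σ; ∃; _×_; _,_)
open import Data.Sum using (_⊎_)
open import Relation.Nullary using (¬_)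
open import Relation.Binary.PropositionalEquality as ≡ using (_≡_)
open import Algebra.Bundles using (CommutativeRing)
open import Function.Bundles using (Bijection)

IsPrimePower : ℕ → Set
IsPrimePower q = Σ ℕ λ p → Σ ℕ λ k → Prime p × q ≡ p ^ suc k

record FiniteField (c ℓ : Level) (q : ℕ) : Set (Level.suc (c ⊔ ℓ)) where
  field
    commRing : CommutativeRing c ℓ
  open CommutativeRing commRing public
  field
    1≉0     : ¬ (1# ≈ 0#)
    inverse : ∀ x → ¬ (x ≈ 0#) → Σ Carrier λ y → x * y ≈ 1#
    card    : Bijection setoid (≡.setoid (Fin q))

-- Polynomials over F: coefficient lists, lowest degree first.
module Poly {c ℓ : Level} {q : ℕ} (F : FiniteField c ℓ q) where
  open FiniteField F

  Pol : Set c
  Pol = List Carrier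

  coeff : Pol → ℕ → Carrier
  coeff []       _       = 0#
  coeff (a ∷ p)  zero    = a
  coeff (a ∷ p)  (suc i) = coeff p i

  -- equality of polynomials (coefficientwise, so trailing zeros are irrelevant)
  _≈ₚ_ : Pol → Pol → Set ℓ
  p ≈ₚ r = ∀ i → coeff p i ≈ coeff r i

  HasDegree : Pol → ℕ → Set ℓ
  HasDegree p d = ¬ (coeff p d ≈ 0#) × (∀ i → d < i → coeff p i ≈ 0#)

  infixl 6 _+ₚ_
  _+ₚ_ : Pol → Pol → Pol
  []      +ₚ r       = r
  (a ∷ p) +ₚ []      = a ∷ p
  (a ∷ p) +ₚ (b ∷ r) = (a + b) ∷ (p +ₚ r)

  scale : Carrier → Pol → Pol
  scale a []      = []
  scale a (b ∷ r) = (a * b) ∷ scale a r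

  negₚ : Pol → Pol
  negₚ []      = []
  negₚ (a ∷ p) = (- a) ∷ negₚ p

  infixl 6 _-ₚ_
  _-ₚ_ : Pol → Pol → Pol
  p -ₚ r = p +ₚ negₚ r

  infixl 7 _*ₚ_
  _*ₚ_ : Pol → Pol → Pol
  []      *ₚ r = []
  (a ∷ p) *ₚ r = scale a r +ₚ (0# ∷ (p *ₚ r))

  natMul : ℕ → Carrier → Carrier
  natMul zero    a = 0#
  natMul (suc n) a = a + natMul n a

  -- formal derivative: (Σ aᵢ xⁱ)' = Σ i·aᵢ xⁱ⁻¹
  derivFrom : ℕ → Pol → Pol
  derivFrom k []      = []
  derivFrom k (a ∷ p) = natMul k a ∷ derivFrom (suc k) p

  deriv : Pol → Pol
  deriv []      = []
  deriv (a ∷ p) = derivFrom 1 p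

  _∣ₚ_ : Pol → Pol → Set (c ⊔ ℓ)
  f ∣ₚ g = Σ Pol λ h → g ≈ₚ (h *ₚ f)

  -- irreducible: positive degree, and any factorisation has a unit (nonzero constant) factor
  Irreducible : Pol → Set (c ⊔ ℓ)
  Irreducible f = (Σ ℕ λ d → 1 ≤ d × HasDegree f d)
                × (∀ g h → f ≈ₚ (g *ₚ h) → HasDegree g 0 ⊎ HasDegree h 0)

  IsSquareMod : Pol → Pol → Set (c ⊔ ℓ)
  IsSquareMod f g = Σ Pol λ s → f ∣ₚ ((s *ₚ s) -ₚ g)

  QuadNonresidueMod : Pol → Pol → Set (c ⊔ ℓ)
  QuadNonresidueMod f g = ¬ IsSquareMod f g

-- Let K = F[x]/⟨f⟩, α the class of x, c the leading coefficient of f, and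
-- σ(y) = y^q the Frobenius map of K.  σ is a ring endomorphism of K fixing the
-- constants (Fermat: a^q = a in F), so the conjugates αᵢ = σⁱ(α) are roots of f.
-- Since y^(q^k) − y vanishes on all q^d residues of degree < d, and a nonzero
-- polynomial over the domain K has at most as many roots as its degree,
-- α₀,…,α_{d−1} are pairwise distinct and σ^d = id.  Hence f = c·∏(x − αⱼ) over K,
-- so f′(αᵢ) = c·∏_{j≠i}(αᵢ − αⱼ), and the norm N(y) = ∏_{i<d} σⁱ(y) satisfies
--   N(f′) = c^d · (−1)^{d(d−1)/2} · V²,   V = ∏_{i<j} (αⱼ − αᵢ).
-- As σ permutes the αᵢ cyclically, σ(V) = (−1)^{d−1}·V = −V for even d, i.e.
-- V^{q−1} = −1, and therefore N(f′)^{(q−1)/2} = −1.  If f′ ≡ s², then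
-- N(f′) = N(s)² with N(s) fixed by σ, so N(f′)^{(q−1)/2} = N(s)^{q−1} = 1.
-- Thus 1 = −1 in K, i.e. 2 = 0 in F, which is impossible as q is odd.
module Submission where

open import Defs
open import Algebra.Bundles using (CommutativeRing)
open import Data.Nat using (ℕ)

module IntegerRingSolver {c ℓ} (R : CommutativeRing c ℓ) where

  open import Data.Nat as ℕ using (ℕ; zero; suc)
  open import Data.Integer as ℤ using (ℤ; +_; -[1+_]; _⊖_)
  import Data.Integer.Properties as ℤP
  open import Data.Sign as Sign using (Sign)
  open import Data.Maybe using (Maybe; just; nothing)
  open import Relation.Nullary using (yes; no)
  open import Relation.Binary.PropositionalEquality as ≡ using (_≡_)
  open import Algebra.Solver.Ring.AlmostCommutativeRing
    using (fromCommutativeRing; _-Raw-AlmostCommutative⟶_; AlmostCommutativeRing)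
  open CommutativeRing R
  open import Algebra.Properties.Semiring.Mult.TCOptimised semiring
  open import Algebra.Properties.Ring ring using (-‿distribˡ-*; -‿distribʳ-*; -‿involutive; -0#≈0#; -‿+-comm)
  open import Relation.Binary.Reasoning.Setoid setoid

  ⟦_⟧ℤ : ℤ → Carrier
  ⟦ + n ⟧ℤ = n × 1#
  ⟦ -[1+ n ] ⟧ℤ = - (suc n × 1#)

  private
    pos◃ : ∀ n → ⟦ Sign.+ ℤ.◃ n ⟧ℤ ≈ n × 1#
    pos◃ zero = refl
    pos◃ (suc n) = refl
    neg◃ : ∀ n → ⟦ Sign.- ℤ.◃ n ⟧ℤ ≈ - (n × 1#)
    neg◃ zero = sym -0#≈0#
    neg◃ (suc n) = refl

    ⊖-homo : ∀ m n → ⟦ m ⊖ n ⟧ℤ ≈ m × 1# - n × 1#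
    ⊖-homo m zero = sym (trans (+-congˡ -0#≈0#) (+-identityʳ _))
    ⊖-homo zero (suc n) = sym (+-identityˡ _)
    ⊖-homo (suc m) (suc n) = begin
      ⟦ suc m ⊖ suc n ⟧ℤ ≡⟨ ≡.cong ⟦_⟧ℤ (ℤP.[1+m]⊖[1+n]≡m⊖n m n) ⟩
      ⟦ m ⊖ n ⟧ℤ ≈⟨ ⊖-homo m n ⟩
      m × 1# - n × 1# ≈⟨ 1+-cancel (m × 1#) (n × 1#) ⟩
      (1# + m × 1#) - (1# + n × 1#) ≈⟨ +-cong (sym (×-homo-+ 1# 1 m)) (-‿cong (sym (×-homo-+ 1# 1 n))) ⟩
      suc m × 1# - suc n × 1# ∎
      where
      1+-cancel : ∀ a b → a - b ≈ (1# + a) - (1# + b)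
      1+-cancel a b = begin
        a - b ≈⟨ +-congʳ (sym (+-identityˡ a)) ⟩
        (0# + a) - b ≈⟨ +-congʳ (+-congʳ (sym (-‿inverseʳ 1#))) ⟩
        ((1# - 1#) + a) - b ≈⟨ +-congʳ (+-assoc 1# (- 1#) a) ⟩
        (1# + (- 1# + a)) - b ≈⟨ +-congʳ (+-congˡ (+-comm (- 1#) a)) ⟩
        (1# + (a - 1#)) - b ≈⟨ +-congʳ (sym (+-assoc 1# a (- 1#))) ⟩
        ((1# + a) - 1#) - b ≈⟨ +-assoc (1# + a) (- 1#) (- b) ⟩
        (1# + a) + (- 1# - b) ≈⟨ +-congˡ (-‿+-comm 1# b) ⟩
        (1# + a) - (1# + b) ∎

  +-homoℤ : ∀ i j → ⟦ i ℤ.+ j ⟧ℤ ≈ ⟦ i ⟧ℤ + ⟦ j ⟧ℤ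
  +-homoℤ (+ m) (+ n) = ×-homo-+ 1# m n
  +-homoℤ (+ m) -[1+ n ] = ⊖-homo m (suc n)
  +-homoℤ -[1+ m ] (+ n) = trans (⊖-homo n (suc m)) (+-comm _ _)
  +-homoℤ -[1+ m ] -[1+ n ] = begin
    - (suc (suc (m ℕ.+ n)) × 1#) ≡⟨ ≡.cong (λ k → - (k × 1#)) (≡.sym (ℕP.+-suc (suc m) n)) ⟩
    - ((suc m ℕ.+ suc n) × 1#) ≈⟨ -‿cong (×-homo-+ 1# (suc m) (suc n)) ⟩
    - (suc m × 1# + suc n × 1#) ≈⟨ sym (-‿+-comm _ _) ⟩
    - (suc m × 1#) - (suc n × 1#) ∎
    where import Data.Nat.Properties as ℕP

  -homoℤ : ∀ i → ⟦ ℤ.- i ⟧ℤ ≈ - ⟦ i ⟧ℤ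
  -homoℤ (+ zero) = sym -0#≈0#
  -homoℤ (+ suc n) = refl
  -homoℤ -[1+ n ] = sym (-‿involutive _)

  *-homoℤ : ∀ i j → ⟦ i ℤ.* j ⟧ℤ ≈ ⟦ i ⟧ℤ * ⟦ j ⟧ℤ
  *-homoℤ (+ m) (+ n) = trans (pos◃ (m ℕ.* n)) (×1-homo-* m n)
  *-homoℤ (+ m) -[1+ n ] = begin
    ⟦ Sign.- ℤ.◃ (m ℕ.* suc n) ⟧ℤ ≈⟨ neg◃ (m ℕ.* suc n) ⟩
    - ((m ℕ.* suc n) × 1#) ≈⟨ -‿cong (×1-homo-* m (suc n)) ⟩
    - ((m × 1#) * (suc n × 1#)) ≈⟨ -‿distribʳ-* _ _ ⟩
    (m × 1#) * - (suc n × 1#) ∎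
  *-homoℤ -[1+ m ] (+ n) = begin
    ⟦ Sign.- ℤ.◃ (suc m ℕ.* n) ⟧ℤ ≈⟨ neg◃ (suc m ℕ.* n) ⟩
    - ((suc m ℕ.* n) × 1#) ≈⟨ -‿cong (×1-homo-* (suc m) n) ⟩
    - ((suc m × 1#) * (n × 1#)) ≈⟨ -‿distribˡ-* _ _ ⟩
    - (suc m × 1#) * (n × 1#) ∎
  *-homoℤ -[1+ m ] -[1+ n ] = begin
    ⟦ Sign.+ ℤ.◃ (suc m ℕ.* suc n) ⟧ℤ ≈⟨ pos◃ (suc m ℕ.* suc n) ⟩
    (suc m ℕ.* suc n) × 1# ≈⟨ ×1-homo-* (suc m) (suc n) ⟩
    (suc m × 1#) * (suc n × 1#) ≈⟨ sym (*-cong (-‿involutive _) refl) ⟩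
    - - (suc m × 1#) * (suc n × 1#) ≈⟨ sym (-‿distribˡ-* _ _) ⟩
    - (- (suc m × 1#) * (suc n × 1#)) ≈⟨ -‿distribʳ-* _ _ ⟩
    - (suc m × 1#) * - (suc n × 1#) ∎

  ACR : AlmostCommutativeRing c ℓ
  ACR = fromCommutativeRing R

  morph : ℤ.+-*-rawRing -Raw-AlmostCommutative⟶ ACR
  morph = record
    { ⟦_⟧ = ⟦_⟧ℤ ; +-homo = +-homoℤ ; *-homo = *-homoℤ ; -‿homo = -homoℤ
    ; 0-homo = refl ; 1-homo = refl }

  -- the solver only needs to recognise equal integer constants
  dec : ∀ i j → Maybe (⟦ i ⟧ℤ ≈ ⟦ j ⟧ℤ)
  dec i j with i ℤ.≟ j
  ... | yes ≡.refl = just refl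
  ... | no _ = nothing

  open import Algebra.Solver.Ring ℤ.+-*-rawRing ACR morph dec public


module ListLemmas where
  open import Data.Nat using (ℕ; zero; suc)
  open import Data.Fin using (Fin; zero; suc; toℕ)
  open import Data.List using (List; []; _∷_; lookup; removeAt; length; tabulate; applyUpTo)
  open import Data.List.Relation.Unary.All using (All; []; _∷_)
  open import Data.List.Relation.Unary.AllPairs using (AllPairs; []; _∷_)
  open import Relation.Binary.PropositionalEquality as ≡ using (_≡_)
  open import Function using (_∘_)

  module _ {a} {A : Set a} where
    All-lookup : ∀ {p} {P : A → Set p} xs (i : Fin (length xs)) → All P xs → P (lookup xs i)
    All-lookup (x ∷ xs) zero (px ∷ _) = px
    All-lookup (x ∷ xs) (suc i) (_ ∷ pxs) = All-lookup xs i pxs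

    All-removeAt : ∀ {p} {P : A → Set p} xs (i : Fin (length xs)) → All P xs → All P (removeAt xs i)
    All-removeAt (x ∷ xs) zero (_ ∷ pxs) = pxs
    All-removeAt (x ∷ xs) (suc i) (px ∷ pxs) = px ∷ All-removeAt xs i pxs

    AllPairs-pick : ∀ {r} {R : A → A → Set r} → (∀ {x y} → R x y → R y x) → ∀ xs (i : Fin (length xs)) →
                    AllPairs R xs → AllPairs R (lookup xs i ∷ removeAt xs i)
    AllPairs-pick sym (x ∷ xs) zero ap = ap
    AllPairs-pick sym (x ∷ xs) (suc i) (px ∷ ap) with AllPairs-pick sym xs i ap
    ... | pl ∷ ap' = (sym (All-lookup xs i px) ∷ pl) ∷ (All-removeAt xs i px ∷ ap')

  tabulate-applyUpTo : ∀ {a b} {A : Set a} {B : Set b} (g : ℕ → A) (h : ℕ → B) n →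
                       tabulate {n = length (applyUpTo g n)} (λ i → h (toℕ i)) ≡ applyUpTo h n
  tabulate-applyUpTo g h zero = ≡.refl
  tabulate-applyUpTo g h (suc n) = ≡.cong (h 0 ∷_) (tabulate-applyUpTo (g ∘ suc) (h ∘ suc) n)


module CommRingTheory {c ℓ} (R : CommutativeRing c ℓ) where

  open import Data.Nat as ℕ using (ℕ; zero; suc)
  import Data.Nat.Properties as ℕP
  open import Data.Fin as Fin using (Fin; zero; suc; toℕ)
  open import Data.List as List using (List; []; _∷_; _++_; map; tabulate; lookup; removeAt; length; applyUpTo)
  import Data.List.Properties as LP
  open import Data.List.Relation.Unary.All as All using (All; []; _∷_)
  open import Data.List.Relation.Unary.AllPairs as AP using (AllPairs; []; _∷_)
  open import Data.Vec as Vec using (Vec; []; _∷_)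
  open import Data.Product using (_×_; _,_; proj₁; proj₂)
  open import Data.Integer using (+_)
  open import Data.Empty using (⊥)
  open import Relation.Nullary using (¬_)
  open import Relation.Binary.PropositionalEquality as ≡ using (_≡_)
  open import Function using (_∘_)

  open CommutativeRing R hiding (zero)
  open import Algebra.Properties.Semiring.Mult semiring using (×-assoc-*; ×1-homo-*; ×-congʳ) renaming (_×_ to _⊠_)
  open import Data.Nat.Primality using (Prime)
  open import Algebra.Properties.Ring ring using (-‿distribʳ-*)
  open import Algebra.Properties.Semiring.Exp semiring using (_^_; ^-congˡ; ^-homo-*; ^-assocʳ)
  open import Relation.Binary.Reasoning.Setoid setoid
  open IntegerRingSolver R using (solve; _:=_; _:+_; _:*_; _:-_; :-_; con)

  prod : List Carrier → Carrier
  prod = List.foldr _*_ 1#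

  prod-++ : ∀ xs ys → prod (xs ++ ys) ≈ prod xs * prod ys
  prod-++ [] ys = sym (*-identityˡ _)
  prod-++ (x ∷ xs) ys = trans (*-congˡ (prod-++ xs ys)) (sym (*-assoc _ _ _))

  prod-map-cong : ∀ {a} {A : Set a} (g h : A → Carrier) → (∀ x → g x ≈ h x) → ∀ xs → prod (map g xs) ≈ prod (map h xs)
  prod-map-cong g h e [] = refl
  prod-map-cong g h e (x ∷ xs) = *-cong (e x) (prod-map-cong g h e xs)

  *-interchange : ∀ a b u v → (a * b) * (u * v) ≈ (a * u) * (b * v)
  *-interchange = solve 4 (λ a b u v → (a :* b) :* (u :* v) := (a :* u) :* (b :* v)) refl

  prod-map-neg : ∀ {a} {A : Set a} (g : A → Carrier) xs → prod (map (λ x → - g x) xs) ≈ (- 1#) ^ length xs * prod (map g xs)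
  prod-map-neg g [] = sym (*-identityˡ _)
  prod-map-neg g (x ∷ xs) = trans (*-congˡ (prod-map-neg g xs)) (regroup (g x) _ _)
    where
    regroup : ∀ a u v → (- a) * (u * v) ≈ (- 1# * u) * (a * v)
    regroup = solve 3 (λ a u v → (:- a) :* (u :* v) := (:- con (+ 1) :* u) :* (a :* v)) refl

  prod-tab-* : ∀ {n} (g h : Fin n → Carrier) → prod (tabulate (λ i → g i * h i)) ≈ prod (tabulate g) * prod (tabulate h)
  prod-tab-* {zero} g h = sym (*-identityˡ _)
  prod-tab-* {suc n} g h = trans (*-congˡ (prod-tab-* (g ∘ suc) (h ∘ suc))) (*-interchange (g zero) (h zero) _ _)

  prod-tab-cong : ∀ {n} (g h : Fin n → Carrier) → (∀ i → g i ≈ h i) → prod (tabulate g) ≈ prod (tabulate h)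
  prod-tab-cong {zero} g h e = refl
  prod-tab-cong {suc n} g h e = *-cong (e zero) (prod-tab-cong (g ∘ suc) (h ∘ suc) (e ∘ suc))

  prod-tab-lookup : ∀ (g : Carrier → Carrier) xs → prod (tabulate (λ i → g (lookup xs i))) ≈ prod (map g xs)
  prod-tab-lookup g [] = refl
  prod-tab-lookup g (x ∷ xs) = *-congˡ (prod-tab-lookup g xs)

  prod-const : ∀ n x → prod (tabulate {n = n} (λ _ → x)) ≈ x ^ n
  prod-const zero x = refl
  prod-const (suc n) x = *-congˡ (prod-const n x)

  diff≈0⇒≈ : ∀ {x y} → x - y ≈ 0# → x ≈ y
  diff≈0⇒≈ {x} {y} e = begin
    x ≈⟨ solve 2 (λ x y → x := (x :- y) :+ y) refl x y ⟩
    (x - y) + y ≈⟨ +-congʳ e ⟩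
    0# + y ≈⟨ +-identityˡ y ⟩
    y ∎

  module IntegralDomain (dom : ∀ x y → x * y ≈ 0# → x ≉ 0# → y ≈ 0#) (1≉0 : 1# ≉ 0#) where

    dom' : ∀ x y → x * y ≈ 0# → y ≉ 0# → x ≈ 0#
    dom' x y e ny = dom y x (trans (*-comm y x) e) ny

    mul≉0 : ∀ x y → x ≉ 0# → y ≉ 0# → x * y ≉ 0#
    mul≉0 x y nx ny e = ny (dom x y e nx)

    prod≉0 : ∀ xs → All (_≉ 0#) xs → prod xs ≉ 0#
    prod≉0 [] [] = 1≉0
    prod≉0 (x ∷ xs) (px ∷ pxs) = mul≉0 x (prod xs) px (prod≉0 xs pxs)

    pow≉0 : ∀ x n → x ≉ 0# → x ^ n ≉ 0#
    pow≉0 x zero nx = 1≉0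
    pow≉0 x (suc n) nx = mul≉0 x (x ^ n) nx (pow≉0 x n nx)

    diff≉0 : ∀ x y → x ≉ y → x - y ≉ 0#
    diff≉0 x y ne e = ne (diff≈0⇒≈ e)

    cancel : ∀ x y z → x ≉ 0# → x * y ≈ x * z → y ≈ z
    cancel x y z nx e = diff≈0⇒≈ (dom x (y - z) x[y-z]≈0 nx)
      where
      x[y-z]≈0 : x * (y - z) ≈ 0#
      x[y-z]≈0 = begin
        x * (y - z) ≈⟨ distribˡ x y (- z) ⟩
        x * y + x * (- z) ≈⟨ +-cong e (sym (-‿distribʳ-* x z)) ⟩
        x * z - x * z ≈⟨ -‿inverseʳ _ ⟩
        0# ∎

  -- The Vandermonde product ∏_{i<j} (xⱼ − xᵢ) of a list x₀,…,x_{n−1}.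
  vandermonde : List Carrier → Carrier
  vandermonde [] = 1#
  vandermonde (b ∷ L) = vandermonde L * prod (map (λ x → x - b) L)

  vandermonde-snoc : ∀ L b → vandermonde (L ++ b ∷ []) ≈ vandermonde L * prod (map (λ x → b - x) L)
  vandermonde-snoc [] b = refl
  vandermonde-snoc (a ∷ L) b = begin
    vandermonde (L ++ b ∷ []) * prod (map (λ x → x - a) (L ++ b ∷ []))
      ≡⟨ ≡.cong (λ z → vandermonde (L ++ b ∷ []) * prod z) (LP.map-++ (λ x → x - a) L (b ∷ [])) ⟩
    vandermonde (L ++ b ∷ []) * prod (map (λ x → x - a) L ++ (b - a) ∷ [])
      ≈⟨ *-cong (vandermonde-snoc L b) (prod-++ (map (λ x → x - a) L) ((b - a) ∷ [])) ⟩
    (vandermonde L * prod (map (λ x → b - x) L)) * (prod (map (λ x → x - a) L) * ((b - a) * 1#))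
      ≈⟨ regroup (vandermonde L) (prod (map (λ x → b - x) L)) (prod (map (λ x → x - a) L)) (b - a) ⟩
    (vandermonde L * prod (map (λ x → x - a) L)) * ((b - a) * prod (map (λ x → b - x) L)) ∎
    where
    regroup : ∀ v u w t → (v * u) * (w * (t * 1#)) ≈ (v * w) * (t * u)
    regroup = solve 4 (λ v u w t → (v :* u) :* (w :* (t :* con (+ 1))) := (v :* w) :* (t :* u)) refl

  -- ∏ᵢ ∏_{j≠i} (xᵢ − xⱼ): the product of the "derivatives at the roots"
  rootDiffProduct : List Carrier → Carrier
  rootDiffProduct L = prod (tabulate (λ i → prod (map (λ y → lookup L i - y) (removeAt L i))))

  -- the number of pairs i < j among n indices, n(n−1)/2
  pairs : ℕ → ℕ
  pairs zero = 0
  pairs (suc n) = n ℕ.+ pairs n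

  neg-diff : ∀ a b → a - b ≈ - (b - a)
  neg-diff = solve 2 (λ a b → a :- b := :- (b :- a)) refl

  -- ∏ᵢ ∏_{j≠i} (xᵢ − xⱼ) = (−1)^{n(n−1)/2} · V², each pair being counted twice
  rootDiffProduct≈vandermonde² : ∀ L → rootDiffProduct L ≈ (- 1#) ^ pairs (length L) * (vandermonde L * vandermonde L)
  rootDiffProduct≈vandermonde² [] = solve 0 (con (+ 1) := con (+ 1) :* (con (+ 1) :* con (+ 1))) refl
  rootDiffProduct≈vandermonde² (b ∷ L) = begin
    A * prod (tabulate (λ i → (lookup L i - b) * inner i))
      ≈⟨ *-congˡ (prod-tab-* (λ i → lookup L i - b) inner) ⟩
    A * (prod (tabulate (λ i → lookup L i - b)) * rootDiffProduct L)
      ≈⟨ *-cong A≈ (*-cong (prod-tab-lookup (λ x → x - b) L) (rootDiffProduct≈vandermonde² L)) ⟩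
    (s1 * B) * (B * (s2 * (vandermonde L * vandermonde L)))
      ≈⟨ regroup s1 s2 B (vandermonde L) ⟩
    (s1 * s2) * ((vandermonde L * B) * (vandermonde L * B))
      ≈⟨ *-congʳ (sym (^-homo-* (- 1#) (length L) (pairs (length L)))) ⟩
    (- 1#) ^ pairs (length (b ∷ L)) * (vandermonde (b ∷ L) * vandermonde (b ∷ L)) ∎
    where
    inner = λ i → prod (map (λ y → lookup L i - y) (removeAt L i))
    A = prod (map (λ x → b - x) L)
    B = prod (map (λ x → x - b) L)
    s1 = (- 1#) ^ length L
    s2 = (- 1#) ^ pairs (length L)
    A≈ : A ≈ s1 * B
    A≈ = trans (prod-map-cong (λ x → b - x) (λ x → - (x - b)) (λ x → neg-diff b x) L)
               (prod-map-neg (λ x → x - b) L)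
    regroup : ∀ s1 s2 B v → (s1 * B) * (B * (s2 * (v * v))) ≈ (s1 * s2) * ((v * B) * (v * B))
    regroup = solve 4 (λ s1 s2 B v → (s1 :* B) :* (B :* (s2 :* (v :* v))) := (s1 :* s2) :* ((v :* B) :* (v :* B))) refl

  prod-applyUpTo-cong : ∀ g h n → (∀ i → g i ≈ h i) → prod (applyUpTo g n) ≈ prod (applyUpTo h n)
  prod-applyUpTo-cong g h zero e = refl
  prod-applyUpTo-cong g h (suc n) e = *-cong (e 0) (prod-applyUpTo-cong (g ∘ suc) (h ∘ suc) n (e ∘ suc))

  prod-applyUpTo-* : ∀ g h n → prod (applyUpTo (λ i → g i * h i) n) ≈ prod (applyUpTo g n) * prod (applyUpTo h n)
  prod-applyUpTo-* g h zero = sym (*-identityˡ 1#)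
  prod-applyUpTo-* g h (suc n) = trans (*-congˡ (prod-applyUpTo-* (g ∘ suc) (h ∘ suc) n)) (*-interchange (g 0) (h 0) _ _)

  prod-rotate : ∀ g n → 1 ℕ.≤ n → g n ≈ g 0 → prod (applyUpTo (g ∘ suc) n) ≈ prod (applyUpTo g n)
  prod-rotate g (suc m) _ e = begin
    prod (applyUpTo (g ∘ suc) (suc m)) ≡⟨ ≡.cong prod (≡.sym (LP.applyUpTo-∷ʳ (g ∘ suc) m)) ⟩
    prod (applyUpTo (g ∘ suc) m ++ g (suc m) ∷ []) ≈⟨ prod-++ (applyUpTo (g ∘ suc) m) (g (suc m) ∷ []) ⟩
    prod (applyUpTo (g ∘ suc) m) * (g (suc m) * 1#) ≈⟨ *-congˡ (trans (*-identityʳ _) e) ⟩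
    prod (applyUpTo (g ∘ suc) m) * g 0 ≈⟨ *-comm (prod (applyUpTo (g ∘ suc) m)) (g 0) ⟩
    g 0 * prod (applyUpTo (g ∘ suc) m) ∎

  -- ... while it multiplies the Vandermonde product by (−1)^(n−1): moving the
  -- first point to the end reverses the sign of n − 1 differences
  vandermonde-rotate : ∀ g n → 1 ℕ.≤ n → g n ≈ g 0 →
                       vandermonde (applyUpTo (g ∘ suc) n) ≈ (- 1#) ^ (n ℕ.∸ 1) * vandermonde (applyUpTo g n)
  vandermonde-rotate g (suc m) _ e = begin
    vandermonde (applyUpTo (g ∘ suc) (suc m)) ≡⟨ ≡.cong vandermonde (≡.sym (LP.applyUpTo-∷ʳ (g ∘ suc) m)) ⟩
    vandermonde (T ++ g (suc m) ∷ []) ≈⟨ vandermonde-snoc T (g (suc m)) ⟩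
    vandermonde T * prod (map (λ x → g (suc m) - x) T)
      ≈⟨ *-congˡ (prod-map-cong (λ x → g (suc m) - x) (λ x → - (x - g 0)) (λ x → trans (+-congʳ e) (neg-diff (g 0) x)) T) ⟩
    vandermonde T * prod (map (λ x → - (x - g 0)) T) ≈⟨ *-congˡ (prod-map-neg (λ x → x - g 0) T) ⟩
    vandermonde T * ((- 1#) ^ length T * B) ≡⟨ ≡.cong (λ l → vandermonde T * ((- 1#) ^ l * B)) (LP.length-applyUpTo (g ∘ suc) m) ⟩
    vandermonde T * ((- 1#) ^ m * B) ≈⟨ solve 3 (λ v s b → v :* (s :* b) := s :* (v :* b)) refl (vandermonde T) ((- 1#) ^ m) B ⟩
    (- 1#) ^ m * (vandermonde T * B) ∎
    where
    T = applyUpTo (g ∘ suc) m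
    B = prod (map (λ x → x - g 0) T)

  module Endomorphism (φ : Carrier → Carrier) (φ-1 : φ 1# ≈ 1#) (φ-* : ∀ x y → φ (x * y) ≈ φ x * φ y)
                      (φ-sub : ∀ x y → φ (x - y) ≈ φ x - φ y) where

    φ-prod : ∀ L → φ (prod L) ≈ prod (map φ L)
    φ-prod [] = φ-1
    φ-prod (x ∷ L) = trans (φ-* x (prod L)) (*-congˡ (φ-prod L))

    φ-vandermonde : ∀ L → φ (vandermonde L) ≈ vandermonde (map φ L)
    φ-vandermonde [] = φ-1
    φ-vandermonde (b ∷ L) = begin
      φ (vandermonde L * prod (map (λ x → x - b) L)) ≈⟨ φ-* (vandermonde L) _ ⟩
      φ (vandermonde L) * φ (prod (map (λ x → x - b) L)) ≈⟨ *-cong (φ-vandermonde L) (φ-prod (map (λ x → x - b) L)) ⟩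
      vandermonde (map φ L) * prod (map φ (map (λ x → x - b) L)) ≡⟨ ≡.cong (λ z → vandermonde (map φ L) * prod z) (≡.sym (LP.map-∘ L)) ⟩
      vandermonde (map φ L) * prod (map (λ x → φ (x - b)) L) ≈⟨ *-congˡ (prod-map-cong (λ x → φ (x - b)) (λ x → φ x - φ b) (λ x → φ-sub x b) L) ⟩
      vandermonde (map φ L) * prod (map (λ x → φ x - φ b) L) ≡⟨ ≡.cong (λ z → vandermonde (map φ L) * prod z) (LP.map-∘ L) ⟩
      vandermonde (map φ L) * prod (map (λ x → x - φ b) (map φ L)) ∎

  horner : ∀ {n} → Vec Carrier (suc n) → Carrier → Carrier
  horner {zero} (c ∷ []) y = c
  horner {suc n} (c ∷ P) y = c + y * horner P y

  hornerDeriv : ∀ {n} → Vec Carrier (suc n) → Carrier → Carrier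
  hornerDeriv {zero} (c ∷ []) y = 0#
  hornerDeriv {suc n} (c ∷ P) y = horner P y + y * hornerDeriv P y

  leading : ∀ {n} → Vec Carrier (suc n) → Carrier
  leading {zero} (c ∷ []) = c
  leading {suc n} (c ∷ P) = leading P

  divLinear : ∀ {n} → Carrier → Vec Carrier (suc (suc n)) → Vec Carrier (suc n) × Carrier
  divLinear {zero} r (p ∷ p2 ∷ []) = (p2 ∷ []) , (p + r * p2)
  divLinear {suc n} r (p ∷ P) = (proj₂ (divLinear r P) ∷ proj₁ (divLinear r P)) , (p + r * proj₂ (divLinear r P))

  divLinear-eval : ∀ {n} r (P : Vec Carrier (suc (suc n))) y →
                   horner P y ≈ (y - r) * horner (proj₁ (divLinear r P)) y + proj₂ (divLinear r P)
  divLinear-eval {zero} r (p ∷ p2 ∷ []) y =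
    solve 4 (λ p p2 y r → p :+ y :* p2 := (y :- r) :* p2 :+ (p :+ r :* p2)) refl p p2 y r
  divLinear-eval {suc n} r (p ∷ P) y = begin
    p + y * horner P y ≈⟨ +-congˡ (*-congˡ (divLinear-eval r P y)) ⟩
    p + y * ((y - r) * horner Q y + e) ≈⟨ regroup p y r (horner Q y) e ⟩
    (y - r) * (e + y * horner Q y) + (p + r * e) ∎
    where
    Q = proj₁ (divLinear r P)
    e = proj₂ (divLinear r P)
    regroup : ∀ p y r q e → p + y * ((y - r) * q + e) ≈ (y - r) * (e + y * q) + (p + r * e)
    regroup = solve 5 (λ p y r q e → p :+ y :* ((y :- r) :* q :+ e) := (y :- r) :* (e :+ y :* q) :+ (p :+ r :* e)) refl

  divLinear-leading : ∀ {n} r (P : Vec Carrier (suc (suc n))) → leading (proj₁ (divLinear r P)) ≡ leading P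
  divLinear-leading {zero} r (p ∷ p2 ∷ []) = ≡.refl
  divLinear-leading {suc n} r (p ∷ P) = divLinear-leading r P

  -- product rule for P = (x − r)·Q + e
  divLinear-deriv : ∀ {n} r (P : Vec Carrier (suc (suc n))) y →
                    hornerDeriv P y ≈ horner (proj₁ (divLinear r P)) y + (y - r) * hornerDeriv (proj₁ (divLinear r P)) y
  divLinear-deriv {zero} r (p ∷ p2 ∷ []) y =
    solve 3 (λ p2 y r → p2 :+ y :* con (+ 0) := p2 :+ (y :- r) :* con (+ 0)) refl p2 y r
  divLinear-deriv {suc n} r (p ∷ P) y = begin
    horner P y + y * hornerDeriv P y ≈⟨ +-cong (divLinear-eval r P y) (*-congˡ (divLinear-deriv r P y)) ⟩
    ((y - r) * qv + e) + y * (qv + (y - r) * qd) ≈⟨ regroup y r qv qd e ⟩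
    (e + y * qv) + (y - r) * (qv + y * qd) ∎
    where
    Q = proj₁ (divLinear r P)
    e = proj₂ (divLinear r P)
    qv = horner Q y
    qd = hornerDeriv Q y
    regroup : ∀ y r qv qd e → ((y - r) * qv + e) + y * (qv + (y - r) * qd) ≈ (e + y * qv) + (y - r) * (qv + y * qd)
    regroup = solve 5 (λ y r qv qd e → ((y :- r) :* qv :+ e) :+ y :* (qv :+ (y :- r) :* qd) := (e :+ y :* qv) :+ (y :- r) :* (qv :+ y :* qd)) refl

  module RootFactorisation (dom : ∀ x y → x * y ≈ 0# → x ≉ 0# → y ≈ 0#) (1≉0 : 1# ≉ 0#) where
    open IntegralDomain dom 1≉0
    open import Data.List.Relation.Unary.All.Properties using (map⁺)
    open ListLemmas using (All-lookup; All-removeAt; AllPairs-pick)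

    Distinct : List Carrier → Set _
    Distinct = AllPairs (λ a b → a ≉ b)

    Roots : ∀ {n} → Vec Carrier (suc n) → List Carrier → Set _
    Roots P = All (λ r → horner P r ≈ 0#)

    root⇒rem≈0 : ∀ {n} r (P : Vec Carrier (suc (suc n))) → horner P r ≈ 0# → proj₂ (divLinear r P) ≈ 0#
    root⇒rem≈0 r P e = begin
      proj₂ (divLinear r P) ≈⟨ solve 2 (λ q e → e := (con (+ 0)) :* q :+ e) refl (horner (proj₁ (divLinear r P)) r) (proj₂ (divLinear r P)) ⟩
      0# * horner (proj₁ (divLinear r P)) r + proj₂ (divLinear r P) ≈⟨ +-congʳ (*-congʳ (sym (-‿inverseʳ r))) ⟩
      (r - r) * horner (proj₁ (divLinear r P)) r + proj₂ (divLinear r P) ≈⟨ sym (divLinear-eval r P r) ⟩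
      horner P r ≈⟨ e ⟩
      0# ∎

    root⇒factor : ∀ {n} r (P : Vec Carrier (suc (suc n))) → horner P r ≈ 0# → ∀ y →
                  horner P y ≈ (y - r) * horner (proj₁ (divLinear r P)) y
    root⇒factor r P e y = trans (divLinear-eval r P y) (trans (+-congˡ (root⇒rem≈0 r P e)) (+-identityʳ _))

    roots-quotient : ∀ {n} r (P : Vec Carrier (suc (suc n))) → horner P r ≈ 0# → ∀ xs → All (λ b → r ≉ b) xs →
                     Roots P xs → Roots (proj₁ (divLinear r P)) xs
    roots-quotient r P rr [] [] [] = []
    roots-quotient r P rr (x ∷ xs) (nx ∷ nxs) (ex ∷ exs) =
      dom (x - r) (horner (proj₁ (divLinear r P)) x) (trans (sym (root⇒factor r P rr x)) ex) (diff≉0 x r (λ e → nx (sym e)))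
      ∷ roots-quotient r P rr xs nxs exs

    factor : ∀ n (P : Vec Carrier (suc n)) (rs : List Carrier) → length rs ≡ n → Distinct rs → Roots P rs →
             ∀ y → horner P y ≈ leading P * prod (map (λ r → y - r) rs)
    factor zero (c ∷ []) [] eq [] [] y = sym (*-identityʳ c)
    factor (suc n) P (r ∷ rs) eq (rd ∷ ds) (rr ∷ rts) y = begin
      horner P y ≈⟨ root⇒factor r P rr y ⟩
      (y - r) * horner Q y ≈⟨ *-congˡ (factor n Q rs (ℕP.suc-injective eq) ds (roots-quotient r P rr rs rd rts) y) ⟩
      (y - r) * (leading Q * prod (map (λ r → y - r) rs)) ≡⟨ ≡.cong (λ t → (y - r) * (t * prod (map (λ r → y - r) rs))) (divLinear-leading r P) ⟩
      (y - r) * (leading P * prod (map (λ r → y - r) rs)) ≈⟨ solve 3 (λ a b c → a :* (b :* c) := b :* (a :* c)) refl (y - r) (leading P) _ ⟩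
      leading P * ((y - r) * prod (map (λ r → y - r) rs)) ∎
      where Q = proj₁ (divLinear r P)

    deriv-at-root : ∀ n (P : Vec Carrier (suc (suc n))) r rs → length rs ≡ n → Distinct (r ∷ rs) → Roots P (r ∷ rs) →
                    hornerDeriv P r ≈ leading P * prod (map (λ x → r - x) rs)
    deriv-at-root n P r rs eq (rd ∷ ds) (rr ∷ rts) = begin
      hornerDeriv P r ≈⟨ divLinear-deriv r P r ⟩
      horner Q r + (r - r) * hornerDeriv Q r ≈⟨ +-congˡ (trans (*-congʳ (-‿inverseʳ r)) (zeroˡ _)) ⟩
      horner Q r + 0# ≈⟨ +-identityʳ _ ⟩
      horner Q r ≈⟨ factor n Q rs eq ds (roots-quotient r P rr rs rd rts) r ⟩
      leading Q * prod (map (λ x → r - x) rs) ≡⟨ ≡.cong (λ t → t * prod (map (λ x → r - x) rs)) (divLinear-leading r P) ⟩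
      leading P * prod (map (λ x → r - x) rs) ∎
      where Q = proj₁ (divLinear r P)

    deriv-at-ith-root : ∀ n (P : Vec Carrier (suc n)) L → length L ≡ n → Distinct L → Roots P L → ∀ (i : Fin (length L)) →
                        hornerDeriv P (lookup L i) ≈ leading P * prod (map (λ x → lookup L i - x) (removeAt L i))
    deriv-at-ith-root (suc n) P L eq dL rL i = deriv-at-root n P (lookup L i) (removeAt L i)
      (ℕP.suc-injective (≡.trans (≡.sym (LP.length-removeAt′ L i)) eq))
      (AllPairs-pick (λ ne e → ne (sym e)) L i dL)
      (All-lookup L i rL ∷ All-removeAt L i rL)
    deriv-at-ith-root zero P [] eq dL rL ()

    vandermonde≉0 : ∀ L → Distinct L → vandermonde L ≉ 0#
    vandermonde≉0 [] _ = 1≉0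
    vandermonde≉0 (b ∷ L) (nb ∷ dL) =
      mul≉0 (vandermonde L) _ (vandermonde≉0 L dL) (prod≉0 _ (map⁺ (All.map (λ {x} ne → diff≉0 x b (λ e → ne (sym e))) nb)))

    root-bound : ∀ n (P : Vec Carrier (suc n)) rs → length rs ≡ suc n → Distinct rs → Roots P rs → leading P ≉ 0# → ⊥
    root-bound n P (z ∷ rs) eq (zd ∷ ds) (zr ∷ rts) nz = nz (dom' (leading P) _ P[z]≈0 factors≉0)
      where
      P[z]≈0 : leading P * prod (map (λ r → z - r) rs) ≈ 0#
      P[z]≈0 = trans (sym (factor n P rs (ℕP.suc-injective eq) ds rts z)) zr
      factors≉0 : prod (map (λ r → z - r) rs) ≉ 0#
      factors≉0 = prod≉0 _ (map⁺ (All.map (λ {x} ne → diff≉0 z x ne) zd))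

  -- In characteristic p (p prime, p·1 = 0) the map y ↦ y^(p^m) is additive:
  -- all middle binomial coefficients of (x + y)^p are divisible by p.
  module FreshmansDream (p : ℕ) (pr : Prime p) (char : p ⊠ 1# ≈ 0#) where
    open import Algebra.Properties.CommutativeSemiring.Binomial commutativeSemiring using (theorem)
    import Algebra.Properties.Semiring.Binomial semiring as Binomial
    open import Algebra.Properties.Monoid.Sum +-monoid using (sum; sum-init-last; sum-cong-≋; sum-replicate-zero)
    open import Data.Nat.Combinatorics using (_C_; nCn≡1; nCk≡nC[n∸k]; nCk≡n!/k![n-k]!; k![n∸k]!∣n!)
    open import Data.Nat.Divisibility using (_∣_; divides; ∣⇒≤; m∣m*n)
    open import Data.Nat.DivMod using (m/n*n≡m)
    open import Data.Nat.Primality using (euclidsLemma; prime⇒nonZero; prime⇒nonTrivial)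
    open import Data.Fin.Properties using (toℕ-inject₁; toℕ-fromℕ; toℕ<n)
    open import Data.Sum using (inj₁; inj₂)
    open import Data.Empty using (⊥-elim)

    private
      p≥2 : 2 ℕ.≤ p
      p≥2 = ℕ.nonTrivial⇒n>1 p {{prime⇒nonTrivial pr}}

    p∤m! : ∀ m → m ℕ.< p → ¬ (p ∣ m ℕ.!)
    p∤m! zero _ d = ℕP.<⇒≱ p≥2 (∣⇒≤ d)
    p∤m! (suc m) m<p d with euclidsLemma (suc m) (m ℕ.!) pr d
    ... | inj₁ d1 = ℕP.<⇒≱ m<p (∣⇒≤ d1)
    ... | inj₂ d2 = p∤m! m (ℕP.<-trans (ℕP.n<1+n m) m<p) d2

    -- p divides (p choose k) for 0 < k < p, since p ∣ p! = (p choose k)·k!·(p−k)!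
    p∣pCk : ∀ k → 0 ℕ.< k → k ℕ.< p → p ∣ (p C k)
    p∣pCk k 0<k k<p with euclidsLemma (p C k) (k ℕ.! ℕ.* (p ℕ.∸ k) ℕ.!) pr (≡.subst (p ∣_) (≡.sym pCk*k!*[p-k]!≡p!) p∣p!)
      where
      k≤p = ℕP.<⇒≤ k<p
      instance _ = ℕP._!*_!≢0 k (p ℕ.∸ k)
      pCk*k!*[p-k]!≡p! : (p C k) ℕ.* (k ℕ.! ℕ.* (p ℕ.∸ k) ℕ.!) ≡ p ℕ.!
      pCk*k!*[p-k]!≡p! = ≡.trans (≡.cong (ℕ._* (k ℕ.! ℕ.* (p ℕ.∸ k) ℕ.!)) (nCk≡n!/k![n-k]! k≤p)) (m/n*n≡m (k![n∸k]!∣n! k≤p))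
      n∣n! : ∀ n → 1 ℕ.≤ n → n ∣ n ℕ.!
      n∣n! (suc n') _ = m∣m*n (n' ℕ.!)
      p∣p! : p ∣ p ℕ.!
      p∣p! = n∣n! p (ℕP.<⇒≤ p≥2)
    ... | inj₁ d = d
    ... | inj₂ d with euclidsLemma (k ℕ.!) ((p ℕ.∸ k) ℕ.!) pr d
    ...   | inj₁ d1 = ⊥-elim (p∤m! k k<p d1)
    ...   | inj₂ d2 = ⊥-elim (p∤m! (p ℕ.∸ k) (ℕP.∸-monoʳ-< 0<k (ℕP.<⇒≤ k<p)) d2)

    p∣m⇒m·z≈0 : ∀ m z → p ∣ m → m ⊠ z ≈ 0#
    p∣m⇒m·z≈0 m z (divides t eq) = begin
      m ⊠ z ≡⟨ ≡.cong (_⊠ z) eq ⟩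
      (t ℕ.* p) ⊠ z ≈⟨ ×-congʳ (t ℕ.* p) (sym (*-identityˡ z)) ⟩
      (t ℕ.* p) ⊠ (1# * z) ≈⟨ sym (×-assoc-* (t ℕ.* p) 1# z) ⟩
      ((t ℕ.* p) ⊠ 1#) * z ≈⟨ *-congʳ (×1-homo-* t p) ⟩
      ((t ⊠ 1#) * (p ⊠ 1#)) * z ≈⟨ *-congʳ (*-congˡ char) ⟩
      ((t ⊠ 1#) * 0#) * z ≈⟨ *-congʳ (zeroʳ _) ⟩
      0# * z ≈⟨ zeroˡ z ⟩
      0# ∎

    module _ (x y : Carrier) where
      open Binomial x y using (binomialExpansion; binomialTerm)

      expansion-extremes : ∀ n → suc n ≡ p → binomialExpansion (suc n) ≈ x ^ suc n + y ^ suc n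
      expansion-extremes n eq = begin
        T zero + sum (λ k → T (suc k)) ≈⟨ +-congˡ (sum-init-last (λ k → T (suc k))) ⟩
        T zero + (sum (λ k → T (suc (Fin.inject₁ k))) + T (suc (Fin.fromℕ n)))
          ≈⟨ +-cong first (+-cong (trans (sum-cong-≋ middle) (sum-replicate-zero n)) last) ⟩
        y ^ suc n + (0# + x ^ suc n) ≈⟨ solve 2 (λ a b → a :+ (con (+ 0) :+ b) := b :+ a) refl (y ^ suc n) (x ^ suc n) ⟩
        x ^ suc n + y ^ suc n ∎
        where
        T = binomialTerm (suc n)
        T≡ : ∀ (k : Fin (suc (suc n))) m → toℕ k ≡ m → T k ≡ ((suc n) C m) ⊠ (x ^ m * y ^ (suc n ℕ.∸ m))
        T≡ k m e = ≡.cong (λ j → ((suc n) C j) ⊠ (x ^ j * y ^ (suc n ℕ.∸ j))) e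
        first : T zero ≈ y ^ suc n
        first = begin
          T zero ≡⟨ ≡.cong (λ c → c ⊠ (x ^ 0 * y ^ suc n)) (≡.trans (nCk≡nC[n∸k] (ℕ.z≤n {suc n})) (nCn≡1 (suc n))) ⟩
          (x ^ 0 * y ^ suc n) + 0# ≈⟨ +-identityʳ _ ⟩
          1# * y ^ suc n ≈⟨ *-identityˡ _ ⟩
          y ^ suc n ∎
        last : T (suc (Fin.fromℕ n)) ≈ x ^ suc n
        last = begin
          T (suc (Fin.fromℕ n)) ≡⟨ T≡ (suc (Fin.fromℕ n)) (suc n) (≡.cong suc (toℕ-fromℕ n)) ⟩
          ((suc n) C (suc n)) ⊠ (x ^ suc n * y ^ (suc n ℕ.∸ suc n)) ≡⟨ ≡.cong₂ (λ c j → c ⊠ (x ^ suc n * y ^ j)) (nCn≡1 (suc n)) (ℕP.n∸n≡0 n) ⟩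
          (x ^ suc n * 1#) + 0# ≈⟨ +-identityʳ _ ⟩
          x ^ suc n * 1# ≈⟨ *-identityʳ _ ⟩
          x ^ suc n ∎
        middle : ∀ (k : Fin n) → T (suc (Fin.inject₁ k)) ≈ 0#
        middle k = begin
          T (suc (Fin.inject₁ k)) ≡⟨ T≡ (suc (Fin.inject₁ k)) (suc (toℕ k)) (≡.cong suc (toℕ-inject₁ k)) ⟩
          ((suc n) C suc (toℕ k)) ⊠ _ ≈⟨ p∣m⇒m·z≈0 _ _ (≡.subst (λ m → p ∣ (m C suc (toℕ k))) (≡.sym eq) p∣C) ⟩
          0# ∎
          where
          p∣C : p ∣ (p C suc (toℕ k))
          p∣C = p∣pCk (suc (toℕ k)) (ℕ.s≤s ℕ.z≤n) (≡.subst (suc (toℕ k) ℕ.<_) eq (ℕ.s≤s (toℕ<n k)))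

    pow-p-+ : ∀ x y → (x + y) ^ p ≈ x ^ p + y ^ p
    pow-p-+ x y = ≡.subst (λ m → (x + y) ^ m ≈ x ^ m + y ^ m) p≡
                   (trans (theorem (suc (ℕ.pred p)) x y) (expansion-extremes x y (ℕ.pred p) p≡))
      where
      p≡ : suc (ℕ.pred p) ≡ p
      p≡ = ℕP.suc-pred p {{prime⇒nonZero pr}}

    pow-p^m-+ : ∀ m x y → (x + y) ^ (p ℕ.^ m) ≈ x ^ (p ℕ.^ m) + y ^ (p ℕ.^ m)
    pow-p^m-+ zero x y = solve 2 (λ x y → (x :+ y) :* con (+ 1) := x :* con (+ 1) :+ y :* con (+ 1)) refl x y
    pow-p^m-+ (suc m) x y = begin
      (x + y) ^ (p ℕ.* p ℕ.^ m) ≈⟨ sym (^-assocʳ (x + y) p (p ℕ.^ m)) ⟩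
      ((x + y) ^ p) ^ (p ℕ.^ m) ≈⟨ ^-congˡ (p ℕ.^ m) (pow-p-+ x y) ⟩
      (x ^ p + y ^ p) ^ (p ℕ.^ m) ≈⟨ pow-p^m-+ m (x ^ p) (y ^ p) ⟩
      (x ^ p) ^ (p ℕ.^ m) + (y ^ p) ^ (p ℕ.^ m) ≈⟨ +-cong (^-assocʳ x p (p ℕ.^ m)) (^-assocʳ y p (p ℕ.^ m)) ⟩
      x ^ (p ℕ.* p ℕ.^ m) + y ^ (p ℕ.* p ℕ.^ m) ∎


module FiniteFieldTheory {c ℓ q} (F : FiniteField c ℓ q) where

  open import Data.Nat as ℕ using (ℕ; zero; suc)
  open import Data.Fin as Fin using (Fin; zero; suc)
  open import Data.Fin.Properties using (punchInᵢ≢i)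
  open import Data.Fin.Permutation using (Permutation; permutation)
  open import Data.Vec.Functional using (removeAt)
  open import Data.Product using (_,_; proj₁; proj₂)
  open import Data.Empty using (⊥-elim)
  open import Relation.Nullary using (¬_; Dec; yes; no)
  open import Relation.Binary.PropositionalEquality as ≡ using (_≡_; _≢_)
  import Algebra.Properties.CommutativeMonoid.Sum as MonoidSum
  open import Function.Bundles using (Bijection)

  open FiniteField F hiding (zero)
  open Bijection card using (to; cong; injective; surjective)
  open import Algebra.Properties.Semiring.Exp semiring using (_^_; ^-congˡ)
  open import Algebra.Properties.Semiring.Mult semiring using (×1-homo-*) renaming (_×_ to _⊠_)
  open import Relation.Binary.Reasoning.Setoid setoid
  open CommRingTheory commRing using (module IntegralDomain)
  open IntegerRingSolver commRing using (solve; _:=_; _:+_; _:*_; _:-_)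

  from : Fin q → Carrier
  from i = proj₁ (surjective i)

  to-from : ∀ i → to (from i) ≡ i
  to-from i = proj₂ (surjective i) refl

  from-to : ∀ x → from (to x) ≈ x
  from-to x = injective (to-from (to x))

  _≟_ : ∀ x y → Dec (x ≈ y)
  x ≟ y with to x Fin.≟ to y
  ... | yes e = yes (injective e)
  ... | no ne = no (λ e → ne (cong e))

  dom : ∀ x y → x * y ≈ 0# → ¬ (x ≈ 0#) → y ≈ 0#
  dom x y e nx with inverse x nx
  ... | z , xz = begin
    y ≈⟨ sym (*-identityˡ y) ⟩
    1# * y ≈⟨ *-congʳ (sym xz) ⟩
    (x * z) * y ≈⟨ solve 3 (λ x z y → (x :* z) :* y := z :* (x :* y)) refl x z y ⟩
    z * (x * y) ≈⟨ *-congˡ e ⟩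
    z * 0# ≈⟨ zeroʳ z ⟩
    0# ∎

  open IntegralDomain dom 1≉0 public

  carrierPermutation : (g h : Carrier → Carrier) → (∀ {x y} → x ≈ y → g x ≈ g y) → (∀ {x y} → x ≈ y → h x ≈ h y) →
                       (∀ x → g (h x) ≈ x) → (∀ x → h (g x) ≈ x) → Permutation q q
  carrierPermutation g h g-cong h-cong gh hg = permutation (λ i → to (g (from i))) (λ i → to (h (from i)))
    (λ i → ≡.trans (cong (trans (g-cong (from-to _)) (gh (from i)))) (to-from i))
    (λ i → ≡.trans (cong (trans (h-cong (from-to _)) (hg (from i)))) (to-from i))

  module Sum = MonoidSum +-commutativeMonoid
  module Prod = MonoidSum *-commutativeMonoid

  -- summing over all of F is invariant under y ↦ y + x, so q·x = 0
  q·x≈0 : ∀ x → q ⊠ x ≈ 0#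
  q·x≈0 x = begin
      q ⊠ x ≈⟨ solve 2 (λ t S → t := (S :+ t) :- S) refl (q ⊠ x) S ⟩
      (S + q ⊠ x) - S ≈⟨ +-congʳ (sym S≈S+q·x) ⟩
      S - S ≈⟨ -‿inverseʳ S ⟩
      0# ∎
    where
    translation = carrierPermutation (_+ x) (_- x) +-congʳ +-congʳ
          (λ y → solve 2 (λ y x → (y :- x) :+ x := y) refl y x)
          (λ y → solve 2 (λ y x → (y :+ x) :- x := y) refl y x)
    S = Sum.sum from
    S≈S+q·x : S ≈ S + q ⊠ x
    S≈S+q·x = begin
      S ≈⟨ Sum.sum-permute from translation ⟩
      Sum.sum (λ i → from (to (from i + x))) ≈⟨ Sum.sum-cong-≋ (λ i → from-to (from i + x)) ⟩
      Sum.sum {q} (λ i → from i + x) ≈⟨ Sum.∑-distrib-+ {q} from (λ _ → x) ⟩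
      S + Sum.sum {q} (λ _ → x) ≈⟨ +-congˡ (Sum.sum-replicate q) ⟩
      S + q ⊠ x ∎

  -- if q = p^(k+1) then p·1 = 0, since (p·1)^(k+1) = q·1 = 0
  characteristic : ∀ p k → q ≡ p ℕ.^ suc k → p ⊠ 1# ≈ 0#
  characteristic p k q≡p^k+1 with (p ⊠ 1#) ≟ 0#
  ... | yes e = e
  ... | no ne = ⊥-elim (pow≉0 (p ⊠ 1#) (suc k) ne
          (trans (sym (pow·1 (suc k))) (trans (≡.subst (λ m → m ⊠ 1# ≈ q ⊠ 1#) q≡p^k+1 refl) (q·x≈0 1#))))
    where
    pow·1 : ∀ m → (p ℕ.^ m) ⊠ 1# ≈ (p ⊠ 1#) ^ m
    pow·1 zero = +-identityʳ 1#
    pow·1 (suc m) = trans (×1-homo-* p (p ℕ.^ m)) (*-congˡ (pow·1 m))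

  -- if q is odd then 2 ≉ 0 in F: otherwise q·1 = 1 + (2t)·1 = 1, while q·1 = 0
  odd⇒2≉0 : ∀ t → q ≡ suc (t ℕ.* 2) → ¬ (1# + 1# ≈ 0#)
  odd⇒2≉0 t q≡2t+1 2≈0 = 1≉0 (begin
    1# ≈⟨ sym (+-identityʳ 1#) ⟩
    1# + 0# ≈⟨ +-congˡ (sym 2t·1≈0) ⟩
    1# + (t ℕ.* 2) ⊠ 1# ≡⟨ ≡.cong (_⊠ 1#) (≡.sym q≡2t+1) ⟩
    q ⊠ 1# ≈⟨ q·x≈0 1# ⟩
    0# ∎)
    where
    2t·1≈0 : (t ℕ.* 2) ⊠ 1# ≈ 0#
    2t·1≈0 = begin
      (t ℕ.* 2) ⊠ 1# ≈⟨ ×1-homo-* t 2 ⟩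
      (t ⊠ 1#) * (1# + (1# + 0#)) ≈⟨ *-congˡ (trans (+-congˡ (+-identityʳ 1#)) 2≈0) ⟩
      (t ⊠ 1#) * 0# ≈⟨ zeroʳ _ ⟩
      0# ∎

  prod-agree-off : ∀ {n} (i : Fin n) (s t : Fin n → Carrier) → (∀ j → j ≢ i → s j ≈ t j) →
                   s i * Prod.sum t ≈ t i * Prod.sum s
  prod-agree-off {suc n} i s t agree = begin
    s i * Prod.sum t ≈⟨ *-congˡ (Prod.sum-remove t) ⟩
    s i * (t i * Prod.sum (removeAt t i)) ≈⟨ *-congˡ (*-congˡ (Prod.sum-cong-≋ (λ j → sym (agree _ (punchInᵢ≢i i j))))) ⟩
    s i * (t i * Prod.sum (removeAt s i)) ≈⟨ solve 3 (λ a b r → a :* (b :* r) := b :* (a :* r)) refl (s i) (t i) _ ⟩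
    t i * (s i * Prod.sum (removeAt s i)) ≈⟨ *-congˡ (sym (Prod.sum-remove s)) ⟩
    t i * Prod.sum s ∎

  orOne : Carrier → Carrier
  orOne y with y ≟ 0#
  ... | yes _ = 1#
  ... | no _ = y

  orOne-zero : ∀ {y} → y ≈ 0# → orOne y ≈ 1#
  orOne-zero {y} e with y ≟ 0#
  ... | yes _ = refl
  ... | no n = ⊥-elim (n e)

  orOne-nonzero : ∀ {y} → ¬ (y ≈ 0#) → orOne y ≈ y
  orOne-nonzero {y} ne with y ≟ 0#
  ... | yes e = ⊥-elim (ne e)
  ... | no _ = refl

  orOne≉0 : ∀ y → ¬ (orOne y ≈ 0#)
  orOne≉0 y with y ≟ 0#
  ... | yes _ = 1≉0
  ... | no ny = ny

  orOne-cong : ∀ {y y'} → y ≈ y' → orOne y ≈ orOne y'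
  orOne-cong {y} {y'} e with y ≟ 0#
  ... | yes y≈0 = sym (orOne-zero (trans (sym e) y≈0))
  ... | no y≉0 = trans e (sym (orOne-nonzero (λ y'≈0 → y≉0 (trans e y'≈0))))

  prodFin≉0 : ∀ {n} (w : Fin n → Carrier) → (∀ i → ¬ (w i ≈ 0#)) → ¬ (Prod.sum w ≈ 0#)
  prodFin≉0 {zero} w nz = 1≉0
  prodFin≉0 {suc n} w nz = mul≉0 (w zero) _ (nz zero) (prodFin≉0 (λ i → w (suc i)) (λ i → nz (suc i)))

  -- Fermat: for x ≉ 0, multiplication by x permutes F, so with
  -- G = ∏_y orOne(y) = ∏_y orOne(x·y) we get x^q·G = ∏_y x·orOne(y) = x·G,
  -- the two products differing only at y = 0.
  fermat : ∀ x → x ^ q ≈ x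
  fermat x with x ≟ 0#
  ... | yes e = trans (^-congˡ q e) (trans (0^q (to 0#)) (sym e))
    where
    0^q : ∀ {n} → Fin n → 0# ^ n ≈ 0#
    0^q {suc n} _ = zeroˡ _
  ... | no x≉0 with inverse x x≉0
  ... | x⁻¹ , xx⁻¹ = cancel G (x ^ q) x G≉0 (trans (*-comm G _) (trans x^q*G≈x*G (*-comm x G)))
    where
    G = Prod.sum (λ i → orOne (from i))
    G≉0 = prodFin≉0 (λ i → orOne (from i)) (λ i → orOne≉0 (from i))
    x*[x⁻¹*y] : ∀ y → x * (x⁻¹ * y) ≈ y
    x*[x⁻¹*y] y = trans (sym (*-assoc x x⁻¹ y)) (trans (*-congʳ xx⁻¹) (*-identityˡ y))
    x⁻¹*[x*y] : ∀ y → x⁻¹ * (x * y) ≈ y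
    x⁻¹*[x*y] y = trans (sym (*-assoc x⁻¹ x y)) (trans (*-congʳ (trans (*-comm x⁻¹ x) xx⁻¹)) (*-identityˡ y))
    scaling = carrierPermutation (x *_) (x⁻¹ *_) *-congˡ *-congˡ x*[x⁻¹*y] x⁻¹*[x*y]
    G≈ : G ≈ Prod.sum (λ i → orOne (x * from i))
    G≈ = begin
      G ≈⟨ Prod.sum-permute (λ i → orOne (from i)) scaling ⟩
      Prod.sum (λ i → orOne (from (to (x * from i)))) ≈⟨ Prod.sum-cong-≋ (λ i → orOne-cong (from-to (x * from i))) ⟩
      Prod.sum (λ i → orOne (x * from i)) ∎
    o = to 0#
    from-o≈0 : from o ≈ 0#
    from-o≈0 = from-to 0#
    agree : ∀ j → j ≢ o → x * orOne (from j) ≈ orOne (x * from j)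
    agree j j≢o = trans (*-congˡ (orOne-nonzero from-j≉0)) (sym (orOne-nonzero (mul≉0 x (from j) x≉0 from-j≉0)))
      where
      from-j≉0 : ¬ (from j ≈ 0#)
      from-j≉0 e = j≢o (≡.trans (≡.sym (to-from j)) (cong e))
    x^q*G≈x*G : x ^ q * G ≈ x * G
    x^q*G≈x*G = begin
      x ^ q * G ≈⟨ *-congʳ (sym (Prod.sum-replicate q)) ⟩
      Prod.sum {q} (λ _ → x) * G ≈⟨ sym (Prod.∑-distrib-+ (λ _ → x) (λ i → orOne (from i))) ⟩
      Prod.sum (λ i → x * orOne (from i)) ≈⟨ sym (*-identityˡ _) ⟩
      1# * Prod.sum (λ i → x * orOne (from i)) ≈⟨ *-congʳ (sym (orOne-zero (trans (*-congˡ from-o≈0) (zeroʳ x)))) ⟩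
      orOne (x * from o) * Prod.sum (λ i → x * orOne (from i))
        ≈⟨ sym (prod-agree-off o (λ i → x * orOne (from i)) (λ i → orOne (x * from i)) agree) ⟩
      (x * orOne (from o)) * Prod.sum (λ i → orOne (x * from i)) ≈⟨ *-cong (trans (*-congˡ (orOne-zero from-o≈0)) (*-identityʳ x)) (sym G≈) ⟩
      x * G ∎


module PolynomialRing {c ℓ q} (F : FiniteField c ℓ q) where

  open import Data.Nat as ℕ using (ℕ; zero; suc)
  import Data.Nat.Properties as ℕP
  open import Data.List as List using (List; []; _∷_; _++_; length)
  import Data.List.Properties as LP
  open import Data.List.Relation.Unary.All as All using (All; []; _∷_)
  import Data.List.Relation.Unary.All.Properties as AllP
  open import Data.List.Relation.Unary.AllPairs as AllPairs using (AllPairs; []; _∷_)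
  import Data.List.Relation.Unary.AllPairs.Properties as APP
  open import Function.Bundles using (Bijection)
  open import Data.Product using (Σ; _×_; _,_; proj₁; proj₂)
  open import Data.Sum using (_⊎_; inj₁; inj₂)
  open import Data.Empty using (⊥-elim)
  open import Relation.Nullary using (¬_; Dec; yes; no)
  open import Relation.Binary.PropositionalEquality as ≡ using (_≡_)
  open import Algebra.Bundles using (CommutativeRing)
  open import Data.Integer using (+_)
  open import Relation.Binary.Definitions using (tri<; tri≈; tri>)

  open FiniteField F hiding (zero)
  open Poly F
  open import Algebra.Properties.Ring ring using (-0#≈0#)
  open import Relation.Binary.Reasoning.Setoid setoid
  open IntegerRingSolver commRing using (solve; _:=_; _:+_; _:*_; _:-_; :-_)
  open FiniteFieldTheory F using (_≟_)

  -- coefficientwise equality, wrapped in a record so that the compared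
  -- polynomials can be inferred from it
  infix 4 _≈P_
  record _≈P_ (p r : Pol) : Set ℓ where
    constructor pw
    field at : ∀ i → coeff p i ≈ coeff r i
  open _≈P_ public

  ≈P-refl : ∀ {p} → p ≈P p
  ≈P-refl = pw λ i → refl
  ≈P-sym : ∀ {p r} → p ≈P r → r ≈P p
  ≈P-sym e = pw λ i → sym (at e i)
  ≈P-trans : ∀ {p r s} → p ≈P r → r ≈P s → p ≈P s
  ≈P-trans e e' = pw λ i → trans (at e i) (at e' i)

  coeff-+ : ∀ p r i → coeff (p +ₚ r) i ≈ coeff p i + coeff r i
  coeff-+ [] r i = sym (+-identityˡ _)
  coeff-+ (a ∷ p) [] i = sym (+-identityʳ _)
  coeff-+ (a ∷ p) (b ∷ r) zero = refl
  coeff-+ (a ∷ p) (b ∷ r) (suc i) = coeff-+ p r i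

  coeff-scale : ∀ a p i → coeff (scale a p) i ≈ a * coeff p i
  coeff-scale a [] i = sym (zeroʳ a)
  coeff-scale a (b ∷ p) zero = refl
  coeff-scale a (b ∷ p) (suc i) = coeff-scale a p i

  coeff-neg : ∀ p i → coeff (negₚ p) i ≈ - coeff p i
  coeff-neg [] i = sym -0#≈0#
  coeff-neg (a ∷ p) zero = refl
  coeff-neg (a ∷ p) (suc i) = coeff-neg p i

  cons-cong : ∀ {a b p r} → a ≈ b → p ≈P r → (a ∷ p) ≈P (b ∷ r)
  cons-cong e e' = pw λ { zero → e ; (suc i) → at e' i }

  cons-tail : ∀ {a b p r} → (a ∷ p) ≈P (b ∷ r) → p ≈P r
  cons-tail e = pw λ i → at e (suc i)

  cons-tail0 : ∀ {a p} → (a ∷ p) ≈P [] → p ≈P []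
  cons-tail0 e = pw λ i → at e (suc i)

  +P-cong : ∀ {p p' r r'} → p ≈P p' → r ≈P r' → (p +ₚ r) ≈P (p' +ₚ r')
  +P-cong {p} {p'} {r} {r'} e e' = pw λ i → trans (coeff-+ p r i) (trans (+-cong (at e i) (at e' i)) (sym (coeff-+ p' r' i)))

  scale-cong : ∀ {a b p r} → a ≈ b → p ≈P r → scale a p ≈P scale b r
  scale-cong {a} {b} {p} {r} e e' = pw λ i → trans (coeff-scale a p i) (trans (*-cong e (at e' i)) (sym (coeff-scale b r i)))

  neg-cong : ∀ {p r} → p ≈P r → negₚ p ≈P negₚ r
  neg-cong {p} {r} e = pw λ i → trans (coeff-neg p i) (trans (-‿cong (at e i)) (sym (coeff-neg r i)))

  *-zeroˡ : ∀ p r → p ≈P [] → (p *ₚ r) ≈P []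
  *-zeroˡ [] r e = ≈P-refl
  *-zeroˡ (a ∷ p) r e = pw λ i → trans (coeff-+ (scale a r) (0# ∷ (p *ₚ r)) i) (trans (+-cong (trans (coeff-scale a r i) (trans (*-congʳ (at e zero)) (zeroˡ _))) (shifted-zero i)) (+-identityʳ 0#))
    where
    shifted-zero : ∀ i → coeff (0# ∷ (p *ₚ r)) i ≈ 0#
    shifted-zero zero = refl
    shifted-zero (suc i) = at (*-zeroˡ p r (cons-tail0 e)) i

  *-congˡP : ∀ {p p'} r → p ≈P p' → (p *ₚ r) ≈P (p' *ₚ r)
  *-congˡP {[]} {[]} r e = ≈P-refl
  *-congˡP {[]} {a' ∷ p'} r e = ≈P-sym (*-zeroˡ (a' ∷ p') r (≈P-sym e))
  *-congˡP {a ∷ p} {[]} r e = *-zeroˡ (a ∷ p) r e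
  *-congˡP {a ∷ p} {a' ∷ p'} r e = +P-cong (scale-cong (at e zero) ≈P-refl) (cons-cong refl (*-congˡP r (cons-tail e)))

  *-congʳP : ∀ p {r r'} → r ≈P r' → (p *ₚ r) ≈P (p *ₚ r')
  *-congʳP [] e = ≈P-refl
  *-congʳP (a ∷ p) e = +P-cong (scale-cong refl e) (cons-cong refl (*-congʳP p e))

  *P-cong : ∀ {p p' r r'} → p ≈P p' → r ≈P r' → (p *ₚ r) ≈P (p' *ₚ r')
  *P-cong {p} {p'} {r} {r'} e e' = ≈P-trans (*-congˡP r e) (*-congʳP p' e')

  +P-assoc : ∀ p r s → ((p +ₚ r) +ₚ s) ≈P (p +ₚ (r +ₚ s))
  +P-assoc p r s = pw λ i → begin
    coeff ((p +ₚ r) +ₚ s) i ≈⟨ coeff-+ (p +ₚ r) s i ⟩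
    coeff (p +ₚ r) i + coeff s i ≈⟨ +-congʳ (coeff-+ p r i) ⟩
    (coeff p i + coeff r i) + coeff s i ≈⟨ +-assoc _ _ _ ⟩
    coeff p i + (coeff r i + coeff s i) ≈⟨ +-congˡ (sym (coeff-+ r s i)) ⟩
    coeff p i + coeff (r +ₚ s) i ≈⟨ sym (coeff-+ p (r +ₚ s) i) ⟩
    coeff (p +ₚ (r +ₚ s)) i ∎

  +P-comm : ∀ p r → (p +ₚ r) ≈P (r +ₚ p)
  +P-comm p r = pw λ i → trans (coeff-+ p r i) (trans (+-comm _ _) (sym (coeff-+ r p i)))

  +P-identityʳ : ∀ p → (p +ₚ []) ≈P p
  +P-identityʳ p = pw λ i → trans (coeff-+ p [] i) (+-identityʳ _)

  negP-inverseˡ : ∀ p → (negₚ p +ₚ p) ≈P []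
  negP-inverseˡ p = pw λ i → trans (coeff-+ (negₚ p) p i) (trans (+-congʳ (coeff-neg p i)) (-‿inverseˡ _))

  negP-inverseʳ : ∀ p → (p +ₚ negₚ p) ≈P []
  negP-inverseʳ p = ≈P-trans (+P-comm p (negₚ p)) (negP-inverseˡ p)

  cons0-zero : ∀ {p} → p ≈P [] → (0# ∷ p) ≈P []
  cons0-zero e = pw λ { zero → refl ; (suc i) → at e i }

  *P-identityˡ : ∀ r → ((1# ∷ []) *ₚ r) ≈P r
  *P-identityˡ r = pw λ i → trans (coeff-+ (scale 1# r) (0# ∷ []) i) (trans (+-cong (coeff-scale 1# r i) (at (cons0-zero {[]} ≈P-refl) i)) (trans (+-identityʳ _) (*-identityˡ _)))

  +P-interchange : ∀ A B C D → ((A +ₚ B) +ₚ (C +ₚ D)) ≈P ((A +ₚ C) +ₚ (B +ₚ D))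
  +P-interchange A B C D = pw λ i → begin
      coeff ((A +ₚ B) +ₚ (C +ₚ D)) i ≈⟨ trans (coeff-+ (A +ₚ B) (C +ₚ D) i) (+-cong (coeff-+ A B i) (coeff-+ C D i)) ⟩
      (coeff A i + coeff B i) + (coeff C i + coeff D i) ≈⟨ solve 4 (λ a b c d → (a :+ b) :+ (c :+ d) := (a :+ c) :+ (b :+ d)) refl _ _ _ _ ⟩
      (coeff A i + coeff C i) + (coeff B i + coeff D i) ≈⟨ sym (trans (coeff-+ (A +ₚ C) (B +ₚ D) i) (+-cong (coeff-+ A C i) (coeff-+ B D i))) ⟩
      coeff ((A +ₚ C) +ₚ (B +ₚ D)) i ∎

  scale-+ˡ : ∀ a a' r → scale (a + a') r ≈P (scale a r +ₚ scale a' r)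
  scale-+ˡ a a' r = pw λ i → trans (coeff-scale (a + a') r i) (trans (distribʳ _ a a') (sym (trans (coeff-+ (scale a r) (scale a' r) i) (+-cong (coeff-scale a r i) (coeff-scale a' r i)))))

  *P-distribʳ : ∀ r p p' → ((p +ₚ p') *ₚ r) ≈P ((p *ₚ r) +ₚ (p' *ₚ r))
  *P-distribʳ r [] p' = ≈P-refl
  *P-distribʳ r (a ∷ p) [] = ≈P-sym (+P-identityʳ _)
  *P-distribʳ r (a ∷ p) (a' ∷ p') = ≈P-trans expand (≈P-trans split0 (+P-interchange (scale a r) (scale a' r) (0# ∷ (p *ₚ r)) (0# ∷ (p' *ₚ r))))
    where
    expand : (scale (a + a') r +ₚ (0# ∷ ((p +ₚ p') *ₚ r))) ≈P ((scale a r +ₚ scale a' r) +ₚ (0# ∷ ((p *ₚ r) +ₚ (p' *ₚ r))))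
    expand = +P-cong (scale-+ˡ a a' r) (cons-cong refl (*P-distribʳ r p p'))
    split0 : ((scale a r +ₚ scale a' r) +ₚ (0# ∷ ((p *ₚ r) +ₚ (p' *ₚ r)))) ≈P ((scale a r +ₚ scale a' r) +ₚ ((0# ∷ (p *ₚ r)) +ₚ (0# ∷ (p' *ₚ r))))
    split0 = +P-cong ≈P-refl (cons-cong (sym (+-identityʳ 0#)) ≈P-refl)

  *-[] : ∀ p → (p *ₚ []) ≈P []
  *-[] [] = ≈P-refl
  *-[] (a ∷ p) = cons0-zero (*-[] p)

  +P-swap : ∀ A B C → (A +ₚ (B +ₚ C)) ≈P (B +ₚ (A +ₚ C))
  +P-swap A B C = pw λ i → begin
    coeff (A +ₚ (B +ₚ C)) i ≈⟨ trans (coeff-+ A (B +ₚ C) i) (+-congˡ (coeff-+ B C i)) ⟩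
    coeff A i + (coeff B i + coeff C i) ≈⟨ solve 3 (λ a b c → a :+ (b :+ c) := b :+ (a :+ c)) refl _ _ _ ⟩
    coeff B i + (coeff A i + coeff C i) ≈⟨ sym (trans (coeff-+ B (A +ₚ C) i) (+-congˡ (coeff-+ A C i))) ⟩
    coeff (B +ₚ (A +ₚ C)) i ∎

  *-cons : ∀ p b r → (p *ₚ (b ∷ r)) ≈P (scale b p +ₚ (0# ∷ (p *ₚ r)))
  *-cons [] b r = ≈P-sym (cons0-zero ≈P-refl)
  *-cons (a ∷ p) b r = cons-cong (+-congʳ (*-comm a b))
    (≈P-trans (+P-cong ≈P-refl (*-cons p b r)) (+P-swap (scale a r) (scale b p) (0# ∷ (p *ₚ r))))

  *P-comm : ∀ p r → (p *ₚ r) ≈P (r *ₚ p)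
  *P-comm [] r = ≈P-sym (*-[] r)
  *P-comm (a ∷ p) r = ≈P-trans (+P-cong ≈P-refl (cons-cong refl (*P-comm p r))) (≈P-sym (*-cons r a p))

  scale-+ʳ : ∀ a u v → scale a (u +ₚ v) ≈P (scale a u +ₚ scale a v)
  scale-+ʳ a u v = pw λ i → trans (coeff-scale a (u +ₚ v) i) (trans (*-congˡ (coeff-+ u v i)) (trans (distribˡ a _ _)
    (sym (trans (coeff-+ (scale a u) (scale a v) i) (+-cong (coeff-scale a u i) (coeff-scale a v i))))))

  scale-scale : ∀ a b s → scale a (scale b s) ≈P scale (a * b) s
  scale-scale a b s = pw λ i → trans (coeff-scale a (scale b s) i) (trans (*-congˡ (coeff-scale b s i)) (trans (sym (*-assoc a b _)) (sym (coeff-scale (a * b) s i))))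

  scale-* : ∀ a r s → scale a (r *ₚ s) ≈P (scale a r *ₚ s)
  scale-* a [] s = ≈P-refl
  scale-* a (b ∷ r) s = ≈P-trans (scale-+ʳ a (scale b s) (0# ∷ (r *ₚ s)))
    (+P-cong (scale-scale a b s) (cons-cong (zeroʳ a) (scale-* a r s)))

  cons0-* : ∀ t s → ((0# ∷ t) *ₚ s) ≈P (0# ∷ (t *ₚ s))
  cons0-* t s = pw λ i → trans (coeff-+ (scale 0# s) (0# ∷ (t *ₚ s)) i) (trans (+-congʳ (trans (coeff-scale 0# s i) (zeroˡ _))) (+-identityˡ _))

  *P-assoc : ∀ p r s → ((p *ₚ r) *ₚ s) ≈P (p *ₚ (r *ₚ s))
  *P-assoc [] r s = ≈P-refl
  *P-assoc (a ∷ p) r s = ≈P-trans (*P-distribʳ s (scale a r) (0# ∷ (p *ₚ r)))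
    (+P-cong (≈P-sym (scale-* a r s)) (≈P-trans (cons0-* (p *ₚ r) s) (cons-cong refl (*P-assoc p r s))))

  PolyRing : CommutativeRing c ℓ
  PolyRing = record
    { Carrier = Pol
    ; _≈_ = _≈P_
    ; _+_ = _+ₚ_
    ; _*_ = _*ₚ_
    ; -_ = negₚ
    ; 0# = []
    ; 1# = 1# ∷ []
    ; isCommutativeRing = record
      { isRing = record
        { +-isAbelianGroup = record
          { isGroup = record
            { isMonoid = record
              { isSemigroup = record
                { isMagma = record
                  { isEquivalence = record { refl = ≈P-refl ; sym = ≈P-sym ; trans = ≈P-trans }
                  ; ∙-cong = +P-cong }
                ; assoc = +P-assoc }
              ; identity = (λ p → ≈P-refl) , +P-identityʳ }
            ; inverse = negP-inverseˡ , negP-inverseʳ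
            ; ⁻¹-cong = neg-cong }
          ; comm = +P-comm }
        ; *-cong = *P-cong
        ; *-assoc = *P-assoc
        ; *-identity = *P-identityˡ , (λ r → ≈P-trans (*P-comm r _) (*P-identityˡ r))
        ; distrib = (λ r p p' → ≈P-trans (*P-comm r (p +ₚ p')) (≈P-trans (*P-distribʳ r p p') (+P-cong (*P-comm p r) (*P-comm p' r))))
                  , *P-distribʳ }
      ; *-comm = *P-comm }
    }

  module PS = IntegerRingSolver PolyRing

  ⟨_⟩ : Carrier → Pol
  ⟨ c ⟩ = c ∷ []

  X : Pol
  X = 0# ∷ 1# ∷ []

  Xmul : ∀ p → (X *ₚ p) ≈P (0# ∷ p)
  Xmul p = ≈P-trans (cons0-* (1# ∷ []) p) (cons-cong refl (*P-identityˡ p))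

  cons-split : ∀ c p → (c ∷ p) ≈P (⟨ c ⟩ +ₚ (X *ₚ p))
  cons-split c p = ≈P-sym (≈P-trans (+P-cong {⟨ c ⟩} ≈P-refl (Xmul p)) (cons-cong (+-identityʳ c) ≈P-refl))

  const-mul : ∀ c r → (⟨ c ⟩ *ₚ r) ≈P scale c r
  const-mul c r = ≈P-trans (+P-cong ≈P-refl (cons0-zero {[]} ≈P-refl)) (+P-identityʳ (scale c r))

  coeff-const-mul : ∀ c r i → coeff (⟨ c ⟩ *ₚ r) i ≈ c * coeff r i
  coeff-const-mul c r i = trans (at (const-mul c r) i) (coeff-scale c r i)

  coeff-*-top : ∀ h g m e → (∀ i → m ℕ.< i → coeff h i ≈ 0#) → (∀ j → e ℕ.< j → coeff g j ≈ 0#) →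
           coeff (h *ₚ g) (m ℕ.+ e) ≈ coeff h m * coeff g e
  coeff-*-top [] g m e hz gz = sym (zeroˡ _)
  coeff-*-top (a ∷ h) g zero e hz gz = begin
      coeff (scale a g +ₚ (0# ∷ (h *ₚ g))) e ≈⟨ coeff-+ (scale a g) _ e ⟩
      coeff (scale a g) e + coeff (0# ∷ (h *ₚ g)) e ≈⟨ +-cong (coeff-scale a g e) (shifted-zero e) ⟩
      a * coeff g e + 0# ≈⟨ +-identityʳ _ ⟩
      a * coeff g e ∎
    where
    hg0 : (h *ₚ g) ≈P []
    hg0 = *-zeroˡ h g (pw λ i → hz (suc i) (ℕ.s≤s ℕ.z≤n))
    shifted-zero : ∀ i → coeff (0# ∷ (h *ₚ g)) i ≈ 0#
    shifted-zero zero = refl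
    shifted-zero (suc i) = at hg0 i
  coeff-*-top (a ∷ h) g (suc m) e hz gz = begin
      coeff (scale a g +ₚ (0# ∷ (h *ₚ g))) (suc (m ℕ.+ e)) ≈⟨ coeff-+ (scale a g) _ (suc (m ℕ.+ e)) ⟩
      coeff (scale a g) (suc (m ℕ.+ e)) + coeff (h *ₚ g) (m ℕ.+ e) ≈⟨ +-cong (trans (coeff-scale a g _) (trans (*-congˡ (gz _ (ℕ.s≤s (ℕP.m≤n+m e m)))) (zeroʳ a)))
                                                                            (coeff-*-top h g m e (λ i m<i → hz (suc i) (ℕ.s≤s m<i)) gz) ⟩
      0# + coeff h m * coeff g e ≈⟨ +-identityˡ _ ⟩
      coeff h m * coeff g e ∎

  Below : ℕ → Pol → Set ℓ
  Below n p = ∀ i → n ℕ.≤ i → coeff p i ≈ 0#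

  zero-or-degree : ∀ p → (p ≈P []) ⊎ Σ ℕ (HasDegree p)
  zero-or-degree [] = inj₁ ≈P-refl
  zero-or-degree (a ∷ p) with zero-or-degree p
  ... | inj₂ (m , nz , above) = inj₂ (suc m , nz , λ { (suc i) (ℕ.s≤s m<i) → above i m<i })
  ... | inj₁ pz with a ≟ 0#
  ...   | yes a0 = inj₁ (pw λ { zero → a0 ; (suc i) → at pz i })
  ...   | no na = inj₂ (zero , na , λ { (suc i) _ → at pz i })

  degree-unique : ∀ p {m n} → HasDegree p m → HasDegree p n → m ≡ n
  degree-unique p {m} {n} (m≉0 , above-m) (n≉0 , above-n) with ℕP.<-cmp m n
  ... | tri< m<n _ _ = ⊥-elim (n≉0 (above-m n m<n))
  ... | tri≈ _ m≡n _ = m≡n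
  ... | tri> _ _ n<m = ⊥-elim (m≉0 (above-n m n<m))

  degree< : ∀ r {m e} → Below e r → HasDegree r m → m ℕ.< e
  degree< r below (nz , _) = ℕP.≰⇒> (λ e≤m → nz (below _ e≤m))

  isZero? : ∀ p → Dec (p ≈P [])
  isZero? p with zero-or-degree p
  ... | inj₁ z = yes z
  ... | inj₂ (m , nz , _) = no (λ z → nz (at z m))

  module Divide (g : Pol) (e : ℕ) (hg : HasDegree g e) where
    b = coeff g e
    binv = proj₁ (inverse b (proj₁ hg))
    b*binv : b * binv ≈ 1#
    b*binv = proj₂ (inverse b (proj₁ hg))

    divide : ∀ P → Σ Pol λ Q → Σ Pol λ R → (P ≈P ((Q *ₚ g) +ₚ R)) × Below e R
    divide [] = [] , [] , ≈P-refl , (λ i _ → refl)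
    divide (c ∷ P') with divide P'
    ... | Q' , R' , eq' , sm' = (t ∷ Q') , (S -ₚ scale t g) , eq , sm
      where
      S = c ∷ R'
      t = coeff S e * binv
      eq : (c ∷ P') ≈P (((t ∷ Q') *ₚ g) +ₚ (S -ₚ scale t g))
      eq = ≈P-trans (cons-cong refl eq') (≈P-trans (cons-split c ((Q' *ₚ g) +ₚ R'))
             (≈P-trans (PS.solve 6 (λ C Xv Q G R T → C PS.:+ Xv PS.:* (Q PS.:* G PS.:+ R) PS.:= (T PS.:+ Xv PS.:* Q) PS.:* G PS.:+ ((C PS.:+ Xv PS.:* R) PS.:- T PS.:* G)) ≈P-refl ⟨ c ⟩ X Q' g R' ⟨ t ⟩)
             (≈P-sym (+P-cong (*-congˡP g (cons-split t Q')) (+P-cong (cons-split c R') (neg-cong (≈P-sym (const-mul t g))))))))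
      coeffR : ∀ i → coeff (S -ₚ scale t g) i ≈ coeff S i - t * coeff g i
      coeffR i = trans (coeff-+ S (negₚ (scale t g)) i) (+-congˡ (trans (coeff-neg (scale t g) i) (-‿cong (coeff-scale t g i))))
      Sz : ∀ i → e ℕ.< i → coeff S i ≈ 0#
      Sz (suc i) (ℕ.s≤s e≤i') = sm' i e≤i'
      sm : Below e (S -ₚ scale t g)
      sm i e≤i with ℕP.m≤n⇒m<n∨m≡n e≤i
      ... | inj₂ ≡.refl = trans (coeffR e) (begin
            coeff S e - (coeff S e * binv) * b ≈⟨ +-congˡ (-‿cong (trans (*-assoc _ _ _) (*-congˡ (trans (*-comm binv b) b*binv)))) ⟩
            coeff S e - coeff S e * 1# ≈⟨ +-congˡ (-‿cong (*-identityʳ _)) ⟩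
            coeff S e - coeff S e ≈⟨ -‿inverseʳ _ ⟩
            0# ∎)
      ... | inj₁ e<i = trans (coeffR i) (trans (+-cong (Sz i e<i) (-‿cong (trans (*-congˡ (proj₂ hg i e<i)) (zeroʳ t)))) (trans (+-congˡ -0#≈0#) (+-identityʳ 0#)))


  elementsF : List Carrier
  elementsF = List.tabulate (FiniteFieldTheory.from F)

  elementsF-distinct : AllPairs (λ a b → ¬ (a ≈ b)) elementsF
  elementsF-distinct = APP.tabulate⁺ (λ {i} {j} i≢j e → i≢j (≡.trans (≡.sym (to-from i)) (≡.trans (Bijection.cong card e) (to-from j))))
    where open FiniteFieldTheory F using (to-from)

  prefixAll : List Carrier → List Pol → List Pol
  prefixAll [] ps = []
  prefixAll (c' ∷ cs) ps = List.map (c' ∷_) ps ++ prefixAll cs ps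

  length-prefixAll : ∀ cs ps → length (prefixAll cs ps) ≡ length cs ℕ.* length ps
  length-prefixAll [] ps = ≡.refl
  length-prefixAll (c' ∷ cs) ps = ≡.trans (LP.length-++ (List.map (c' ∷_) ps)) (≡.cong₂ ℕ._+_ (LP.length-map (c' ∷_) ps) (length-prefixAll cs ps))

  allPolys : ℕ → List Pol
  allPolys zero = [] ∷ []
  allPolys (suc n) = prefixAll elementsF (allPolys n)

  length-allPolys : ∀ n → length (allPolys n) ≡ q ℕ.^ n
  length-allPolys zero = ≡.refl
  length-allPolys (suc n) = ≡.trans (length-prefixAll elementsF (allPolys n)) (≡.cong₂ ℕ._*_ (LP.length-tabulate (FiniteFieldTheory.from F)) (length-allPolys n))

  below-prefixAll : ∀ n cs ps → All (Below n) ps → All (Below (suc n)) (prefixAll cs ps)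
  below-prefixAll n [] ps _ = []
  below-prefixAll n (c' ∷ cs) ps sp = AllP.++⁺ (AllP.map⁺ (All.map (λ {u} su → λ { (suc i) (ℕ.s≤s n≤i) → su i n≤i }) sp)) (below-prefixAll n cs ps sp)

  below-allPolys : ∀ n → All (Below n) (allPolys n)
  below-allPolys zero = (λ i _ → refl) ∷ []
  below-allPolys (suc n) = below-prefixAll n elementsF (allPolys n) (below-allPolys n)

  head-differs : ∀ c' cs ps → All (λ c'' → ¬ (c' ≈ c'')) cs → All (λ v → ¬ (c' ≈ coeff v 0)) (prefixAll cs ps)
  head-differs c' [] ps _ = []
  head-differs c' (c'' ∷ cs) ps (ne ∷ nes) = AllP.++⁺ (AllP.map⁺ (All.universal (λ u → ne) ps)) (head-differs c' cs ps nes)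

  distinct-prefixAll : ∀ cs ps → AllPairs (λ a b → ¬ (a ≈ b)) cs → AllPairs (λ u v → ¬ (u ≈P v)) ps →
                       AllPairs (λ u v → ¬ (u ≈P v)) (prefixAll cs ps)
  distinct-prefixAll [] ps _ _ = []
  distinct-prefixAll (c' ∷ cs) ps (nc ∷ dcs) dps =
    APP.++⁺ (APP.map⁺ (AllPairs.map (λ ne e → ne (cons-tail e)) dps)) (distinct-prefixAll cs ps dcs dps)
      (AllP.map⁺ (All.universal (λ u → All.map (λ {v} ne e → ne (at e 0)) (head-differs c' cs ps nc)) ps))

  distinct-allPolys : ∀ n → AllPairs (λ u v → ¬ (u ≈P v)) (allPolys n)
  distinct-allPolys zero = [] ∷ []
  distinct-allPolys (suc n) = distinct-prefixAll elementsF (allPolys n) elementsF-distinct (distinct-allPolys n)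


module ResidueRing {c ℓ q} (F : FiniteField c ℓ q) (f : Poly.Pol F) (d : ℕ)
  (hd : Poly.HasDegree F f d) (irr : Poly.Irreducible F f) where
  open import Data.Nat as ℕ using (ℕ; zero; suc)
  import Data.Nat.Properties as ℕP
  open import Data.List using ([]; _∷_)
  open import Data.Product using (Σ; _,_; proj₁; proj₂)
  open import Data.Sum using (inj₁; inj₂)
  open import Data.Empty using (⊥-elim)
  open import Relation.Nullary using (¬_; Dec; yes; no)
  open import Relation.Binary.PropositionalEquality as ≡ using (_≡_)
  open import Algebra.Bundles using (CommutativeRing)
  open import Level using (_⊔_)

  open FiniteField F hiding (zero)
  open Poly F
  open import Algebra.Properties.Ring ring using (-0#≈0#)
  open import Relation.Binary.Reasoning.Setoid setoid
  open FiniteFieldTheory F using (mul≉0)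
  open CommRingTheory commRing using (diff≈0⇒≈)
  open PolynomialRing F

  Dvd : Pol → Set (c ⊔ ℓ)
  Dvd g = Σ Pol λ h → g ≈P (h *ₚ f)

  lc≉0 : ¬ (coeff f d ≈ 0#)
  lc≉0 = proj₁ hd

  d≥1 : 1 ℕ.≤ d
  d≥1 with proj₁ irr
  ... | d' , 1≤d' , hd' = ≡.subst (1 ℕ.≤_) (degree-unique f hd' hd) 1≤d'

  -- the only residue divisible by f is 0 (compare top coefficients)
  small-dvd⇒≈0 : ∀ R → Below d R → Dvd R → R ≈P []
  small-dvd⇒≈0 R sm (h , eq) with zero-or-degree h
  ... | inj₁ hz = ≈P-trans eq (*-zeroˡ h f hz)
  ... | inj₂ (m , nz , ab) = ⊥-elim (mul≉0 _ _ nz lc≉0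
          (trans (sym (coeff-*-top h f m d ab (proj₂ hd))) (trans (sym (at eq (m ℕ.+ d))) (sm (m ℕ.+ d) (ℕP.m≤n+m d m)))))

  open Divide f d hd renaming (divide to divideByF)

  Dvd-resp : ∀ {p p'} → p ≈P p' → Dvd p → Dvd p'
  Dvd-resp e (h , eq) = h , ≈P-trans (≈P-sym e) eq

  Dvd-0 : Dvd []
  Dvd-0 = [] , ≈P-refl

  Dvd-+ : ∀ {a b} → Dvd a → Dvd b → Dvd (a +ₚ b)
  Dvd-+ {a} {b} (H , e) (H' , e') = (H +ₚ H') , ≈P-trans (+P-cong e e') (≈P-sym (*P-distribʳ f H H'))

  Dvd-* : ∀ r {a} → Dvd a → Dvd (r *ₚ a)
  Dvd-* r {a} (H , e) = (r *ₚ H) , ≈P-trans (*-congʳP r e) (≈P-sym (*P-assoc r H f))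

  Dvd-neg : ∀ {a} → Dvd a → Dvd (negₚ a)
  Dvd-neg {a} (H , e) = negₚ H , ≈P-trans (neg-cong e) (PS.solve 2 (λ H F → PS.:- (H PS.:* F) PS.:= (PS.:- H) PS.:* F) ≈P-refl H f)

  Dvd-f* : ∀ h → Dvd (f *ₚ h)
  Dvd-f* h = h , *P-comm f h

  -- if a = b·c + R then R·h = a·h − b·(c·h), so f ∣ a·h and f ∣ c·h give f ∣ R·h
  Dvd-rem : ∀ a b c R h → a ≈P ((b *ₚ c) +ₚ R) → Dvd (a *ₚ h) → Dvd (c *ₚ h) → Dvd (R *ₚ h)
  Dvd-rem a b c R h eq ah ch = Dvd-resp R*h≈ (Dvd-+ ah (Dvd-neg (Dvd-* b ch)))
    where
    R*h≈ : ((a *ₚ h) +ₚ negₚ (b *ₚ (c *ₚ h))) ≈P (R *ₚ h)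
    R*h≈ = ≈P-trans (+P-cong (*-congˡP h eq) ≈P-refl)
           (PS.solve 4 (λ b c R h → (b PS.:* c PS.:+ R) PS.:* h PS.:- b PS.:* (c PS.:* h) PS.:= R PS.:* h) ≈P-refl b c R h)

  -- divisibility by f is decidable: look at the remainder
  dvd? : ∀ g → Dec (Dvd g)
  dvd? g with divideByF g
  ... | Q , R , eq , sm with isZero? R
  ...   | yes z = yes (Q , ≈P-trans eq (≈P-trans (+P-cong ≈P-refl z) (+P-identityʳ _)))
  ...   | no nz = no λ { (h , eqh) → nz (small-dvd⇒≈0 R sm (negₚ Q +ₚ h , R≈ h eqh)) }
    where
    R≈ : ∀ h → g ≈P (h *ₚ f) → R ≈P ((negₚ Q +ₚ h) *ₚ f)
    R≈ h eqh = ≈P-trans (PS.solve 3 (λ R Q F → R PS.:= (Q PS.:* F PS.:+ R) PS.:+ (PS.:- Q PS.:* F)) ≈P-refl R Q f)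
      (≈P-trans (+P-cong (≈P-trans (≈P-sym eq) eqh) ≈P-refl)
        (PS.solve 3 (λ H Q F → H PS.:* F PS.:+ (PS.:- Q PS.:* F) PS.:= (PS.:- Q PS.:+ H) PS.:* F) ≈P-refl h Q f))

  unit-cancel : ∀ r h → HasDegree r 0 → Dvd (r *ₚ h) → Dvd h
  unit-cancel r h (nz , ab) (H , eqH) = (⟨ ci ⟩ *ₚ H) , eqn
    where
    c0 = coeff r 0
    ci = proj₁ (inverse c0 nz)
    r≈ : r ≈P ⟨ c0 ⟩
    r≈ = pw λ { zero → refl ; (suc i) → ab (suc i) (ℕ.s≤s ℕ.z≤n) }
    ci*c0≈1 : (⟨ ci ⟩ *ₚ ⟨ c0 ⟩) ≈P (1# ∷ [])
    ci*c0≈1 = ≈P-trans (const-mul ci ⟨ c0 ⟩) (cons-cong (trans (*-comm ci c0) (proj₂ (inverse c0 nz))) ≈P-refl)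
    eqn : h ≈P ((⟨ ci ⟩ *ₚ H) *ₚ f)
    eqn = ≈P-trans (≈P-sym (*P-identityˡ h)) (≈P-trans (*-congˡP h (≈P-sym ci*c0≈1))
          (≈P-trans (*P-assoc ⟨ ci ⟩ ⟨ c0 ⟩ h) (≈P-trans (*-congʳP ⟨ ci ⟩ (≈P-trans (*-congˡP h (≈P-sym r≈)) eqH))
          (≈P-sym (*P-assoc ⟨ ci ⟩ H f)))))

  -- f has no factor r of degree e with 1 ≤ e < d: irreducibility would make
  -- the cofactor constant, forcing deg f = e
  no-proper-factor : ∀ r e Q → 1 ℕ.≤ e → e ℕ.< d → HasDegree r e → ¬ (f ≈P (Q *ₚ r))
  no-proper-factor r e Q 1≤e e<d hr f≈Qr with proj₂ irr Q r (at f≈Qr)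
  ... | inj₂ hr0 = ⊥-elim (proj₁ hr (proj₂ hr0 e 1≤e))
  ... | inj₁ hq0 = lc≉0 (begin
        coeff f d ≈⟨ at f≈Qr d ⟩
        coeff (Q *ₚ r) d ≈⟨ at (*-congˡP r Q≈) d ⟩
        coeff (⟨ coeff Q 0 ⟩ *ₚ r) d ≈⟨ coeff-const-mul _ r d ⟩
        coeff Q 0 * coeff r d ≈⟨ *-congˡ (proj₂ hr d e<d) ⟩
        coeff Q 0 * 0# ≈⟨ zeroʳ _ ⟩
        0# ∎)
    where
    Q≈ : Q ≈P ⟨ coeff Q 0 ⟩
    Q≈ = pw λ { zero → refl ; (suc i) → proj₂ hq0 (suc i) (ℕ.s≤s ℕ.z≤n) }

  -- By induction on e (with
  -- fuel n > e): divide f by r; the remainder is nonzero by no-proper-factor,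
  -- has smaller degree, and f still divides its product with h.
  cancel-small : ∀ h n r e → e ℕ.< n → HasDegree r e → e ℕ.< d → Dvd (r *ₚ h) → Dvd h
  cancel-small h (suc n) r zero _ hr _ rh = unit-cancel r h hr rh
  cancel-small h (suc n) r (suc e) (ℕ.s≤s e<n) hr e<d rh with Divide.divide r (suc e) hr f
  ... | Q , R , f≈Qr+R , R-small with zero-or-degree R
  ...   | inj₁ R≈0 = ⊥-elim (no-proper-factor r (suc e) Q (ℕ.s≤s ℕ.z≤n) e<d hr
                       (≈P-trans f≈Qr+R (≈P-trans (+P-cong ≈P-refl R≈0) (+P-identityʳ _))))
  ...   | inj₂ (e' , hR) = cancel-small h n R e' (ℕP.<-≤-trans e'<e+1 e<n) hR (ℕP.<-trans e'<e+1 e<d)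
                             (Dvd-rem f Q r R h f≈Qr+R (Dvd-f* h) rh)
    where
    e'<e+1 : e' ℕ.< suc e
    e'<e+1 = degree< R R-small hR

  -- Euclid's lemma for the irreducible f: reduce g modulo f and cancel the remainder
  euclid : ∀ g h → Dvd (g *ₚ h) → ¬ Dvd g → Dvd h
  euclid g h gh ¬f∣g with divideByF g
  ... | Q , R , g≈Qf+R , R-small with zero-or-degree R
  ...   | inj₁ R≈0 = ⊥-elim (¬f∣g (Q , ≈P-trans g≈Qf+R (≈P-trans (+P-cong ≈P-refl R≈0) (+P-identityʳ _))))
  ...   | inj₂ (e , hR) = cancel-small h (suc e) R e (ℕP.n<1+n e) hR (degree< R R-small hR)
                            (Dvd-rem g Q f R h g≈Qf+R gh (Dvd-f* h))

  infix 4 _≈K_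
  record _≈K_ (a b : Pol) : Set (c ⊔ ℓ) where
    constructor kq
    field kget : Dvd (a -ₚ b)
  open _≈K_ public

  ≈P⇒≈K : ∀ {a b} → a ≈P b → a ≈K b
  ≈P⇒≈K {a} {b} e = kq (Dvd-resp (≈P-sym (≈P-trans (+P-cong e ≈P-refl) (negP-inverseʳ b))) Dvd-0)

  K-refl : ∀ {a} → a ≈K a
  K-refl = ≈P⇒≈K ≈P-refl

  K-sym : ∀ {a b} → a ≈K b → b ≈K a
  K-sym {a} {b} (kq e) = kq (Dvd-resp (PS.solve 2 (λ a b → PS.:- (a PS.:- b) PS.:= b PS.:- a) ≈P-refl a b) (Dvd-neg e))

  K-trans : ∀ {a b c'} → a ≈K b → b ≈K c' → a ≈K c'
  K-trans {a} {b} {c'} (kq e) (kq e') = kq (Dvd-resp (PS.solve 3 (λ a b c → (a PS.:- b) PS.:+ (b PS.:- c) PS.:= a PS.:- c) ≈P-refl a b c') (Dvd-+ e e'))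

  K+-cong : ∀ {a a' b b'} → a ≈K a' → b ≈K b' → (a +ₚ b) ≈K (a' +ₚ b')
  K+-cong {a} {a'} {b} {b'} (kq e) (kq e') = kq (Dvd-resp (PS.solve 4 (λ a a' b b' → (a PS.:- a') PS.:+ (b PS.:- b') PS.:= (a PS.:+ b) PS.:- (a' PS.:+ b')) ≈P-refl a a' b b') (Dvd-+ e e'))

  K*-cong : ∀ {a a' b b'} → a ≈K a' → b ≈K b' → (a *ₚ b) ≈K (a' *ₚ b')
  K*-cong {a} {a'} {b} {b'} (kq e) (kq e') = kq (Dvd-resp (PS.solve 4 (λ a a' b b' → b PS.:* (a PS.:- a') PS.:+ a' PS.:* (b PS.:- b') PS.:= (a PS.:* b) PS.:- (a' PS.:* b')) ≈P-refl a a' b b') (Dvd-+ (Dvd-* b e) (Dvd-* a' e')))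

  Kneg-cong : ∀ {a a'} → a ≈K a' → negₚ a ≈K negₚ a'
  Kneg-cong {a} {a'} (kq e) = kq (Dvd-resp (PS.solve 2 (λ a a' → PS.:- (a PS.:- a') PS.:= (PS.:- a) PS.:- (PS.:- a')) ≈P-refl a a') (Dvd-neg e))

  private module PR = CommutativeRing PolyRing

  K : CommutativeRing c (c ⊔ ℓ)
  K = record
    { Carrier = Pol
    ; _≈_ = _≈K_
    ; _+_ = _+ₚ_
    ; _*_ = _*ₚ_
    ; -_ = negₚ
    ; 0# = []
    ; 1# = 1# ∷ []
    ; isCommutativeRing = record
      { isRing = record
        { +-isAbelianGroup = record
          { isGroup = record
            { isMonoid = record
              { isSemigroup = record
                { isMagma = record
                  { isEquivalence = record { refl = K-refl ; sym = K-sym ; trans = K-trans }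
                  ; ∙-cong = K+-cong }
                ; assoc = λ a b c → ≈P⇒≈K (PR.+-assoc a b c) }
              ; identity = (λ a → ≈P⇒≈K (PR.+-identityˡ a)) , (λ a → ≈P⇒≈K (PR.+-identityʳ a)) }
            ; inverse = (λ a → ≈P⇒≈K (PR.-‿inverseˡ a)) , (λ a → ≈P⇒≈K (PR.-‿inverseʳ a))
            ; ⁻¹-cong = Kneg-cong }
          ; comm = λ a b → ≈P⇒≈K (PR.+-comm a b) }
        ; *-cong = K*-cong
        ; *-assoc = λ a b c → ≈P⇒≈K (PR.*-assoc a b c)
        ; *-identity = (λ a → ≈P⇒≈K (PR.*-identityˡ a)) , (λ a → ≈P⇒≈K (PR.*-identityʳ a))
        ; distrib = (λ a b c → ≈P⇒≈K (PR.distribˡ a b c)) , (λ a b c → ≈P⇒≈K (PR.distribʳ a b c)) }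
      ; *-comm = λ a b → ≈P⇒≈K (PR.*-comm a b) }
    }

  K0→Dvd : ∀ {x} → x ≈K [] → Dvd x
  K0→Dvd {x} (kq e) = Dvd-resp (+P-identityʳ x) e

  Dvd→K0 : ∀ {x} → Dvd x → x ≈K []
  Dvd→K0 {x} e = kq (Dvd-resp (≈P-sym (+P-identityʳ x)) e)

  K-dom : ∀ x y → (x *ₚ y) ≈K [] → ¬ (x ≈K []) → y ≈K []
  K-dom x y e nx = Dvd→K0 (euclid x y (K0→Dvd e) (λ dx → nx (Dvd→K0 dx)))

  K-dec : ∀ a b → Dec (a ≈K b)
  K-dec a b with dvd? (a -ₚ b)
  ... | yes e = yes (kq e)
  ... | no ne = no (λ e → ne (kget e))

  small-inj : ∀ u v → Below d u → Below d v → u ≈K v → u ≈P v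
  small-inj u v su sv e = pw λ i → coeff-agree i (at (small-dvd⇒≈0 (u -ₚ v) sm (kget e)) i)
    where
    sm : Below d (u -ₚ v)
    sm i d≤i = trans (coeff-+ u (negₚ v) i) (trans (+-cong (su i d≤i) (trans (coeff-neg v i) (trans (-‿cong (sv i d≤i)) -0#≈0#))) (+-identityʳ 0#))
    coeff-agree : ∀ i → coeff (u -ₚ v) i ≈ 0# → coeff u i ≈ coeff v i
    coeff-agree i z = diff≈0⇒≈ (trans (sym (trans (coeff-+ u (negₚ v) i) (+-congˡ (coeff-neg v i)))) z)

  -- a constant vanishing in K vanishes in F, since d ≥ 1
  const≈0 : ∀ a → ⟨ a ⟩ ≈K [] → a ≈ 0#
  const≈0 a e = at (small-inj ⟨ a ⟩ [] a-below (λ i _ → refl) e) 0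
    where
    a-below : Below d ⟨ a ⟩
    a-below (suc i) _ = refl
    a-below zero d≤0 = ⊥-elim (ℕP.<⇒≱ d≥1 d≤0)

  const≉0 : ∀ a → ¬ (a ≈ 0#) → ¬ (⟨ a ⟩ ≈K [])
  const≉0 a a≉0 e = a≉0 (const≈0 a e)

  K1≉0 : ¬ ((1# ∷ []) ≈K [])
  K1≉0 = const≉0 1# 1≉0


module Conjugates {c ℓ} (q : ℕ) (ppow : IsPrimePower q) (F : FiniteField c ℓ q) (f : Poly.Pol F) (d : ℕ)
  (irr : Poly.Irreducible F f) (hd : Poly.HasDegree F f d) where
  open import Data.Nat as ℕ using (ℕ; zero; suc)
  import Data.Nat.Properties as ℕP
  open import Data.Product using (Σ; _,_; proj₁; proj₂)
  open import Data.List as List using (List; []; _∷_; map; length; lookup; removeAt; tabulate; applyUpTo)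
  import Data.List.Properties as LP
  open import Data.List.Relation.Unary.All as All using (All; []; _∷_)
  import Data.List.Relation.Unary.All.Properties as AllP
  open import Data.List.Relation.Unary.AllPairs using (AllPairs; []; _∷_)
  import Data.List.Relation.Unary.AllPairs.Properties as APP
  open import Data.Vec using (Vec; []; _∷_)
  open import Data.Fin using (Fin; toℕ)
  open import Data.Sum using (inj₁; inj₂)
  open import Data.Empty using (⊥-elim)
  open import Relation.Nullary using (¬_; yes; no)
  open import Relation.Binary.PropositionalEquality as ≡ using (_≡_)
  open import Function using (_∘_)
  open import Data.Integer using (+_)
  open import Data.Nat.Primality using (Prime; prime⇒nonTrivial)
  open import Algebra.Bundles using (CommutativeRing)

  open FiniteField F using () renaming (_≈_ to _≈F_; 0# to 0F)
  open Poly F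
  open PolynomialRing F using (_≈P_; pw; at; ⟨_⟩; X; ≈P-refl; ≈P-sym; ≈P-trans; cons-cong; +P-cong; *P-cong; cons-split; *P-identityˡ; +P-identityʳ;
                               Below; allPolys; length-allPolys; below-allPolys; distinct-allPolys)
  open FiniteFieldTheory F using (fermat; characteristic)
  open ResidueRing F f d hd irr
  open ListLemmas

  p = proj₁ ppow
  k = proj₁ (proj₂ ppow)
  pr : Prime p
  pr = proj₁ (proj₂ (proj₂ ppow))
  q≡p^k+1 : q ≡ p ℕ.^ suc k
  q≡p^k+1 = proj₂ (proj₂ (proj₂ ppow))

  -- from here on, ring operations and equality are those of K
  open CommutativeRing K hiding (zero)
  open import Algebra.Properties.Ring ring using (-‿involutive; -0#≈0#)
  open import Algebra.Properties.Semiring.Exp semiring using (_^_; ^-congˡ; ^-homo-*; ^-assocʳ)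
  open import Algebra.Properties.CommutativeSemiring.Exp commutativeSemiring using (^-distrib-*)
  open import Algebra.Properties.Semiring.Mult semiring using () renaming (_×_ to _⊠_)
  open import Algebra.Properties.Semiring.Mult (FiniteField.semiring F) using () renaming (_×_ to _⊠F_)
  open import Relation.Binary.Reasoning.Setoid setoid
  open IntegerRingSolver K using (solve; _:=_; _:+_; _:*_; _:-_; :-_; con)
  open CommRingTheory K
  open IntegralDomain K-dom K1≉0
  open RootFactorisation K-dom K1≉0

  q≥2 : 2 ℕ.≤ q
  q≥2 = ≡.subst (2 ℕ.≤_) (≡.sym q≡p^k+1) (ℕP.≤-trans p≥2 (ℕP.m≤m*n p (p ℕ.^ k) {{ℕP.m^n≢0 p k {{ℕ.>-nonZero (ℕP.<-trans ℕP.0<1+n p≥2)}}}}))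
    where
    p≥2 : 2 ℕ.≤ p
    p≥2 = ℕ.nonTrivial⇒n>1 p {{prime⇒nonTrivial pr}}

  -- needed by the monotonicity lemmas for q ℕ.^ _
  instance
    q-nonZero : ℕ.NonZero q
    q-nonZero = ℕ.>-nonZero (ℕP.<-trans ℕP.0<1+n q≥2)

  charK : p ⊠ 1# ≈ 0#
  charK = trans (≈P⇒≈K (natK p)) (≈P⇒≈K (pw λ { zero → characteristic p k q≡p^k+1 ; (suc i) → FiniteField.refl F }))
    where
    natK : ∀ n → (n ⊠ 1#) ≈P ⟨ n ⊠F FiniteField.1# F ⟩
    natK zero = pw λ { zero → FiniteField.refl F ; (suc i) → FiniteField.refl F }
    natK (suc n) = +P-cong {FiniteField.1# F ∷ []} ≈P-refl (natK n)

  open FreshmansDream p pr charK using (pow-p^m-+)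

  σ : Pol → Pol
  σ y = y ^ q

  σ-cong : ∀ {x y} → x ≈ y → σ x ≈ σ y
  σ-cong = ^-congˡ q

  σ-+ : ∀ x y → σ (x + y) ≈ σ x + σ y
  σ-+ x y = ≡.subst (λ m → (x + y) ^ m ≈ x ^ m + y ^ m) (≡.sym q≡p^k+1) (pow-p^m-+ (suc k) x y)

  σ-* : ∀ x y → σ (x * y) ≈ σ x * σ y
  σ-* x y = ^-distrib-* x y q

  σ-0 : σ 0# ≈ 0#
  σ-0 = 0^n≈0 q (ℕP.<⇒≤ q≥2)
    where
    0^n≈0 : ∀ n → 1 ℕ.≤ n → 0# ^ n ≈ 0#
    0^n≈0 (suc n) _ = zeroˡ (0# ^ n)

  one^ : ∀ n → 1# ^ n ≈ 1#
  one^ zero = refl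
  one^ (suc n) = trans (*-identityˡ _) (one^ n)

  σ-1 : σ 1# ≈ 1#
  σ-1 = one^ q

  σ-sub : ∀ x y → σ (x - y) ≈ σ x - σ y
  σ-sub x y = trans (σ-+ x (- y)) (+-congˡ σ-neg)
    where
    σ-neg : σ (- y) ≈ - σ y
    σ-neg = begin
      σ (- y) ≈⟨ solve 2 (λ a b → a := (a :+ b) :- b) refl (σ (- y)) (σ y) ⟩
      (σ (- y) + σ y) - σ y ≈⟨ +-congʳ (trans (sym (σ-+ (- y) y)) (trans (σ-cong (-‿inverseˡ y)) σ-0)) ⟩
      0# - σ y ≈⟨ +-identityˡ _ ⟩
      - σ y ∎

  σ-const : ∀ a → σ ⟨ a ⟩ ≈ ⟨ a ⟩
  σ-const a = ≈P⇒≈K (≈P-trans (const^ q) (cons-cong (fermat a) ≈P-refl))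
    where
    open import Algebra.Properties.Semiring.Exp (FiniteField.semiring F) using () renaming (_^_ to _^F_)
    const^ : ∀ n → (⟨ a ⟩ ^ n) ≈P ⟨ a ^F n ⟩
    const^ zero = ≈P-refl
    const^ (suc n) = ≈P-trans (*P-cong (≈P-refl {⟨ a ⟩}) (const^ n)) (pw λ { zero → FiniteField.+-identityʳ F _ ; (suc i) → FiniteField.refl F })

  -- σ is injective: σ(x − y) = 0 forces x − y = 0 in the domain K
  σ-inj : ∀ x y → σ x ≈ σ y → x ≈ y
  σ-inj x y e with K-dec (x - y) 0#
  ... | yes x-y≈0 = diff≈0⇒≈ x-y≈0
  ... | no x-y≉0 = ⊥-elim (pow≉0 (x - y) q x-y≉0 (trans (σ-sub x y) (trans (+-congʳ e) (-‿inverseʳ (σ y)))))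

  iter : ℕ → Pol → Pol
  iter zero y = y
  iter (suc i) y = σ (iter i y)

  iter-cong : ∀ i {x y} → x ≈ y → iter i x ≈ iter i y
  iter-cong zero e = e
  iter-cong (suc i) e = σ-cong (iter-cong i e)

  iter-+ : ∀ i x y → iter i (x + y) ≈ iter i x + iter i y
  iter-+ zero x y = refl
  iter-+ (suc i) x y = trans (σ-cong (iter-+ i x y)) (σ-+ _ _)

  iter-* : ∀ i x y → iter i (x * y) ≈ iter i x * iter i y
  iter-* zero x y = refl
  iter-* (suc i) x y = trans (σ-cong (iter-* i x y)) (σ-* _ _)

  iter-const : ∀ i a → iter i ⟨ a ⟩ ≈ ⟨ a ⟩
  iter-const zero a = refl
  iter-const (suc i) a = trans (σ-cong (iter-const i a)) (σ-const a)

  iter-0 : ∀ i → iter i 0# ≈ 0#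
  iter-0 zero = refl
  iter-0 (suc i) = trans (σ-cong (iter-0 i)) σ-0

  iter-add : ∀ a b y → iter (a ℕ.+ b) y ≡ iter a (iter b y)
  iter-add zero b y = ≡.refl
  iter-add (suc a) b y = ≡.cong σ (iter-add a b y)

  iter-inj : ∀ i x y → iter i x ≈ iter i y → x ≈ y
  iter-inj zero x y e = e
  iter-inj (suc i) x y e = iter-inj i x y (σ-inj _ _ e)

  iter-pow : ∀ i y → iter i y ≈ y ^ (q ℕ.^ i)
  iter-pow zero y = sym (*-identityʳ y)
  iter-pow (suc i) y = begin
    σ (iter i y) ≈⟨ σ-cong (iter-pow i y) ⟩
    (y ^ (q ℕ.^ i)) ^ q ≈⟨ ^-assocʳ y (q ℕ.^ i) q ⟩
    y ^ (q ℕ.^ i ℕ.* q) ≡⟨ ≡.cong (y ^_) (ℕP.*-comm (q ℕ.^ i) q) ⟩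
    y ^ (q ℕ.^ suc i) ∎

  -- Evaluating at α = [x] gives back the class of the polynomial, and σⁱ
  -- commutes with evaluation since it fixes the coefficients.
  evK : Pol → Pol → Pol
  evK [] y = 0#
  evK (a ∷ g) y = ⟨ a ⟩ + y * evK g y

  evK-X : ∀ g → evK g X ≈ g
  evK-X g = ≈P⇒≈K (evK-XP g)
    where
    evK-XP : ∀ g → evK g X ≈P g
    evK-XP [] = ≈P-refl
    evK-XP (a ∷ g) = ≈P-trans (+P-cong (≈P-refl {⟨ a ⟩}) (*P-cong (≈P-refl {X}) (evK-XP g))) (≈P-sym (cons-split a g))

  evK-cong : ∀ g {x y} → x ≈ y → evK g x ≈ evK g y
  evK-cong [] e = refl
  evK-cong (a ∷ g) e = +-congˡ (*-cong e (evK-cong g e))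

  iter-evK : ∀ i g y → iter i (evK g y) ≈ evK g (iter i y)
  iter-evK i [] y = iter-0 i
  iter-evK i (a ∷ g) y = trans (iter-+ i ⟨ a ⟩ (y * evK g y))
    (+-cong (iter-const i a) (trans (iter-* i y (evK g y)) (*-congˡ {iter i y} (iter-evK i g y))))

  α : ℕ → Pol
  α i = iter i X

  f-at-α : ∀ i → evK f (α i) ≈ 0#
  f-at-α i = begin
    evK f (α i) ≈⟨ sym (iter-evK i f X) ⟩
    iter i (evK f X) ≈⟨ iter-cong i (trans (evK-X f) f≈0) ⟩
    iter i 0# ≈⟨ iter-0 i ⟩
    0# ∎
    where
    f≈0 : f ≈ 0#
    f≈0 = kq ((FiniteField.1# F ∷ []) , ≈P-sym (≈P-trans (*P-identityˡ f) (≈P-sym (+P-identityʳ f))))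

  -- if σᵏ fixes α it fixes everything, as K is generated by α
  fixes-α⇒fixes-all : ∀ i → α i ≈ X → ∀ y → iter i y ≈ y
  fixes-α⇒fixes-all i e y = begin
    iter i y ≈⟨ iter-cong i (sym (evK-X y)) ⟩
    iter i (evK y X) ≈⟨ iter-evK i y X ⟩
    evK y (iter i X) ≈⟨ evK-cong y e ⟩
    evK y X ≈⟨ evK-X y ⟩
    y ∎

  -- A polynomial over F of degree ≤ n as a coefficient vector over K, so that
  -- evaluation and the formal derivative become horner / hornerDeriv.
  tailP : Pol → Pol
  tailP [] = []
  tailP (_ ∷ g) = g

  coeffVec : Pol → (n : ℕ) → Vec Pol (suc n)
  coeffVec g zero = ⟨ coeff g 0 ⟩ ∷ []
  coeffVec g (suc n) = ⟨ coeff g 0 ⟩ ∷ coeffVec (tailP g) n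

  leading-coeffVec : ∀ g n → leading (coeffVec g n) ≡ ⟨ coeff g n ⟩
  leading-coeffVec g zero = ≡.refl
  leading-coeffVec g (suc n) = ≡.trans (leading-coeffVec (tailP g) n) (≡.cong ⟨_⟩ (coeff-tail g n))
    where
    coeff-tail : ∀ g n → coeff (tailP g) n ≡ coeff g (suc n)
    coeff-tail [] n = ≡.refl
    coeff-tail (_ ∷ g) n = ≡.refl

  const-zero : ∀ {a} → a ≈F 0F → ⟨ a ⟩ ≈ 0#
  const-zero e = ≈P⇒≈K (pw λ { zero → e ; (suc i) → FiniteField.refl F })

  evK-zero : ∀ g y → (∀ j → coeff g j ≈F 0F) → evK g y ≈ 0#
  evK-zero [] y z = refl
  evK-zero (a ∷ g) y z = trans (+-cong (const-zero (z 0)) (trans (*-congˡ {y} (evK-zero g y (λ j → z (suc j)))) (zeroʳ y))) (+-identityʳ 0#)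

  evK≈horner : ∀ g n y → Below (suc n) g → evK g y ≈ horner (coeffVec g n) y
  evK≈horner [] zero y hz = sym (const-zero (FiniteField.refl F))
  evK≈horner (a ∷ g) zero y hz = trans (+-congˡ {⟨ a ⟩} (trans (*-congˡ {y} (evK-zero g y (λ j → hz (suc j) (ℕ.s≤s ℕ.z≤n)))) (zeroʳ y))) (+-identityʳ _)
  evK≈horner [] (suc n) y hz = sym (trans (+-cong (const-zero (FiniteField.refl F)) (trans (*-congˡ {y} (sym (evK≈horner [] n y (λ _ _ → FiniteField.refl F)))) (zeroʳ y))) (+-identityʳ 0#))
  evK≈horner (a ∷ g) (suc n) y hz = +-congˡ {⟨ a ⟩} (*-congˡ {y} (evK≈horner g n y (λ j n<j → hz (suc j) (ℕ.s≤s n<j))))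

  -- The formal derivative, evaluated: the k-shifted derivative satisfies
  -- (derivFrom (k+1) g)(y) = (derivFrom k g)(y) + g(y), whence the product rule
  -- (a + x·g)′ = g + x·g′.
  natMul-zero : ∀ k {b} → b ≈F 0F → natMul k b ≈F 0F
  natMul-zero zero e = FiniteField.refl F
  natMul-zero (suc k) e = FiniteField.trans F (FiniteField.+-cong F e (natMul-zero k e)) (FiniteField.+-identityʳ F 0F)

  derivFrom-zero : ∀ k g y → (∀ j → coeff g j ≈F 0F) → evK (derivFrom k g) y ≈ 0#
  derivFrom-zero k [] y z = refl
  derivFrom-zero k (b ∷ g) y z =
    trans (+-cong (const-zero (natMul-zero k (z 0))) (trans (*-congˡ {y} (derivFrom-zero (suc k) g y (λ j → z (suc j)))) (zeroʳ y))) (+-identityʳ 0#)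

  derivFrom-suc : ∀ k g y → evK (derivFrom (suc k) g) y ≈ evK (derivFrom k g) y + evK g y
  derivFrom-suc k [] y = sym (+-identityʳ 0#)
  derivFrom-suc k (b ∷ g) y = begin
    (⟨ b ⟩ + ⟨ natMul k b ⟩) + y * evK (derivFrom (suc (suc k)) g) y ≈⟨ +-congˡ {⟨ b ⟩ + ⟨ natMul k b ⟩} (*-congˡ {y} (derivFrom-suc (suc k) g y)) ⟩
    (⟨ b ⟩ + ⟨ natMul k b ⟩) + y * (evK (derivFrom (suc k) g) y + evK g y)
      ≈⟨ solve 5 (λ B N y D E → (B :+ N) :+ y :* (D :+ E) := (N :+ y :* D) :+ (B :+ y :* E)) refl ⟨ b ⟩ ⟨ natMul k b ⟩ y _ _ ⟩
    (⟨ natMul k b ⟩ + y * evK (derivFrom (suc k) g) y) + (⟨ b ⟩ + y * evK g y) ∎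

  derivFrom-0 : ∀ g y → evK (derivFrom 0 g) y ≈ y * evK (deriv g) y
  derivFrom-0 [] y = sym (zeroʳ y)
  derivFrom-0 (b ∷ g) y = trans (+-congʳ (const-zero (FiniteField.refl F))) (+-identityˡ _)

  deriv-cons : ∀ a g y → evK (deriv (a ∷ g)) y ≈ evK g y + y * evK (deriv g) y
  deriv-cons a g y = trans (derivFrom-suc 0 g y) (trans (+-congʳ (derivFrom-0 g y)) (+-comm (y * evK (deriv g) y) (evK g y)))

  evK-deriv≈hornerDeriv : ∀ g n y → Below (suc n) g → evK (deriv g) y ≈ hornerDeriv (coeffVec g n) y
  evK-deriv≈hornerDeriv [] zero y hz = refl
  evK-deriv≈hornerDeriv (a ∷ g) zero y hz = derivFrom-zero 1 g y (λ j → hz (suc j) (ℕ.s≤s ℕ.z≤n))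
  evK-deriv≈hornerDeriv [] (suc n) y hz =
    sym (trans (+-cong (sym (evK≈horner [] n y (λ _ _ → FiniteField.refl F))) (trans (*-congˡ {y} (sym (evK-deriv≈hornerDeriv [] n y (λ _ _ → FiniteField.refl F)))) (zeroʳ y))) (+-identityʳ 0#))
  evK-deriv≈hornerDeriv (a ∷ g) (suc n) y hz =
    trans (deriv-cons a g y) (+-cong (evK≈horner g n y hz') (*-congˡ {y} (evK-deriv≈hornerDeriv g n y hz')))
    where
    hz' : Below (suc n) g
    hz' j n<j = hz (suc j) (ℕ.s≤s n<j)

  fVec : Vec Pol (suc d)
  fVec = coeffVec f d

  lc : Pol
  lc = ⟨ coeff f d ⟩

  lc≉0K : ¬ (lc ≈ 0#)
  lc≉0K = const≉0 (coeff f d) lc≉0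

  leading-fVec : leading fVec ≡ lc
  leading-fVec = leading-coeffVec f d

  roots-fVec : ∀ n → Roots fVec (applyUpTo α n)
  roots-fVec n = AllP.applyUpTo⁺₂ α n (λ j → trans (sym (evK≈horner f d (α j) (proj₂ hd))) (f-at-α j))

  residues-distinct : ∀ us → All (Below d) us → AllPairs (λ u v → ¬ (u ≈P v)) us → Distinct us
  residues-distinct [] _ _ = []
  residues-distinct (u ∷ us) (su ∷ sus) (nu ∷ dus) = differ us sus nu ∷ residues-distinct us sus dus
    where
    differ : ∀ vs → All (Below d) vs → All (λ v → ¬ (u ≈P v)) vs → All (λ v → ¬ (u ≈ v)) vs
    differ [] _ _ = []
    differ (v ∷ vs) (sv ∷ svs) (n ∷ ns) = (λ e → n (small-inj u v su sv e)) ∷ differ vs svs ns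

  powVec : (M : ℕ) → Vec Pol (suc M)
  powVec zero = 1# ∷ []
  powVec (suc M) = 0# ∷ powVec M

  horner-powVec : ∀ M y → horner (powVec M) y ≈ y ^ M
  horner-powVec zero y = refl
  horner-powVec (suc M) y = trans (+-identityˡ _) (*-congˡ {y} (horner-powVec M y))

  leading-powVec : ∀ M → leading (powVec M) ≡ 1#
  leading-powVec zero = ≡.refl
  leading-powVec (suc M) = leading-powVec M

  -- For 1 ≤ i < d, σⁱ moves α.  Otherwise σⁱ = id, so all q^d residues of
  -- degree < d would be roots of y^(q^i) − y, which has degree q^i < q^d.
  α-moves : ∀ i → 1 ℕ.≤ i → i ℕ.< d → ¬ (α i ≈ X)
  α-moves i 1≤i i<d e with q^i≡M+2
    where
    q^i≡M+2 : Σ ℕ λ M → q ℕ.^ i ≡ suc (suc M)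
    q^i≡M+2 = two+ (q ℕ.^ i) (ℕP.≤-trans q≥2 (ℕP.≤-trans (ℕP.≤-reflexive (≡.sym (ℕP.*-identityʳ q))) (ℕP.^-monoʳ-≤ q 1≤i)))
      where
      two+ : ∀ N → 2 ℕ.≤ N → Σ ℕ λ M → N ≡ suc (suc M)
      two+ (suc (suc M)) _ = M , ≡.refl
      two+ (suc zero) (ℕ.s≤s ())
  ... | M , q^i≡ = root-bound (suc (suc M)) P rs length-rs rs-distinct rs-roots leading-P≉0
    where
    -- P = y^(M+2) − y = σⁱ(y) − y
    P : Vec Pol (suc (suc (suc M)))
    P = 0# ∷ (- 1#) ∷ powVec M
    P-vanishes : ∀ y → horner P y ≈ 0#
    P-vanishes y = begin
      0# + y * (- 1# + y * horner (powVec M) y) ≈⟨ +-congˡ {0#} (*-congˡ {y} (+-congˡ { - 1#} (*-congˡ {y} (horner-powVec M y)))) ⟩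
      0# + y * (- 1# + y * y ^ M) ≈⟨ solve 2 (λ y w → con (+ 0) :+ y :* (:- con (+ 1) :+ y :* w) := y :* (y :* w) :- y) refl y (y ^ M) ⟩
      y ^ (suc (suc M)) - y ≈⟨ +-congʳ (≡.subst (λ m → y ^ m ≈ iter i y) q^i≡ (sym (iter-pow i y))) ⟩
      iter i y - y ≈⟨ +-congʳ (fixes-α⇒fixes-all i e y) ⟩
      y - y ≈⟨ -‿inverseʳ y ⟩
      0# ∎
    M+3≤q^d : suc (suc (suc M)) ℕ.≤ q ℕ.^ d
    M+3≤q^d = ≡.subst (λ m → suc m ℕ.≤ q ℕ.^ d) q^i≡ (ℕP.^-monoʳ-< q q≥2 i<d)
    rs = List.take (suc (suc (suc M))) (allPolys d)
    length-rs : length rs ≡ suc (suc (suc M))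
    length-rs = ≡.trans (LP.length-take (suc (suc (suc M))) (allPolys d))
                        (ℕP.m≤n⇒m⊓n≡m (ℕP.≤-trans M+3≤q^d (ℕP.≤-reflexive (≡.sym (length-allPolys d)))))
    rs-distinct : Distinct rs
    rs-distinct = APP.take⁺ (suc (suc (suc M))) (residues-distinct (allPolys d) (below-allPolys d) (distinct-allPolys d))
    rs-roots : Roots P rs
    rs-roots = All.universal P-vanishes rs
    leading-P≉0 : ¬ (leading P ≈ 0#)
    leading-P≉0 = ≡.subst (λ t → ¬ (t ≈ 0#)) (≡.sym (leading-powVec M)) K1≉0

  -- σ is injective, so αᵢ ≈ αⱼ for i < j means that σ^(j−i) fixes α
  conjugate-shift : ∀ i j → i ℕ.< j → α i ≈ α j → α (j ℕ.∸ i) ≈ X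
  conjugate-shift i j i<j e = sym (iter-inj i X (α (j ℕ.∸ i)) (trans e (≡.subst (λ t → t ≈ iter i (α (j ℕ.∸ i))) αj≡ refl)))
    where
    αj≡ : iter i (α (j ℕ.∸ i)) ≡ α j
    αj≡ = ≡.trans (≡.sym (iter-add i (j ℕ.∸ i) X)) (≡.cong α (ℕP.m+[n∸m]≡n (ℕP.<⇒≤ i<j)))

  conjugates-distinct : ∀ i j → i ℕ.< j → j ℕ.< d → ¬ (α i ≈ α j)
  conjugates-distinct i j i<j j<d e =
    α-moves (j ℕ.∸ i) (ℕP.m<n⇒0<n∸m i<j) (ℕP.≤-<-trans (ℕP.m∸n≤m j i) j<d) (conjugate-shift i j i<j e)

  conjugates : List Pol
  conjugates = applyUpTo α d

  conjugates-Distinct : Distinct conjugates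
  conjugates-Distinct = APP.applyUpTo⁺₁ α d (λ {i} {j} i<j j<d → conjugates-distinct i j i<j j<d)

  -- σ^d(α) = α: otherwise α₀, …, α_d would be d+1 distinct roots of f
  α-period : α d ≈ X
  α-period with K-dec (α d) X
  ... | yes e = e
  ... | no αd≉α = ⊥-elim (root-bound d fVec (applyUpTo α (suc d)) (LP.length-applyUpTo α (suc d)) distinct (roots-fVec (suc d)) leading≉0)
    where
    leading≉0 : ¬ (leading fVec ≈ 0#)
    leading≉0 = ≡.subst (λ t → ¬ (t ≈ 0#)) (≡.sym leading-fVec) lc≉0K
    distinct : Distinct (applyUpTo α (suc d))
    distinct = APP.applyUpTo⁺₁ α (suc d) (λ {i} {j} i<j j<d+1 → differ i j i<j (ℕP.≤-pred j<d+1))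
      where
      differ : ∀ i j → i ℕ.< j → j ℕ.≤ d → ¬ (α i ≈ α j)
      differ i j i<j j≤d with ℕP.m≤n⇒m<n∨m≡n j≤d
      ... | inj₁ j<d = conjugates-distinct i j i<j j<d
      ... | inj₂ ≡.refl with i
      ...   | zero = λ e → αd≉α (sym e)
      ...   | suc i' = λ e → α-moves (j ℕ.∸ suc i') (ℕP.m<n⇒0<n∸m i<j) (ℕP.∸-monoʳ-< (ℕ.s≤s ℕ.z≤n) (ℕP.<⇒≤ i<j))
                               (conjugate-shift (suc i') j i<j e)

  σ^d≈id : ∀ y → iter d y ≈ y
  σ^d≈id = fixes-α⇒fixes-all d α-period

  -- The norm N(y) = ∏_{i<d} σⁱ(y): multiplicative and fixed by σ (as σ^d = id).
  norm : Pol → Pol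
  norm y = prod (applyUpTo (λ i → iter i y) d)

  norm-cong : ∀ {x y} → x ≈ y → norm x ≈ norm y
  norm-cong {x} {y} e = prod-applyUpTo-cong (λ i → iter i x) (λ i → iter i y) d (λ i → iter-cong i e)

  norm-* : ∀ x y → norm (x * y) ≈ norm x * norm y
  norm-* x y = trans (prod-applyUpTo-cong _ (λ i → iter i x * iter i y) d (λ i → iter-* i x y))
                     (prod-applyUpTo-* (λ i → iter i x) (λ i → iter i y) d)

  open Endomorphism σ σ-1 σ-* σ-sub

  σ-norm : ∀ y → σ (norm y) ≈ norm y
  σ-norm y = begin
    σ (norm y) ≈⟨ φ-prod (applyUpTo (λ i → iter i y) d) ⟩
    prod (map σ (applyUpTo (λ i → iter i y) d)) ≡⟨ ≡.cong prod (LP.map-applyUpTo (λ i → iter i y) σ d) ⟩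
    prod (applyUpTo (λ i → iter (suc i) y) d) ≈⟨ prod-rotate (λ i → iter i y) d d≥1 (σ^d≈id y) ⟩
    norm y ∎

  -- V = vandermonde of the conjugates; σ shifts them cyclically, so
  -- σ(V) = (−1)^(d−1)·V
  V : Pol
  V = vandermonde conjugates

  σ-V : σ V ≈ (- 1#) ^ (d ℕ.∸ 1) * V
  σ-V = begin
    σ V ≈⟨ φ-vandermonde conjugates ⟩
    vandermonde (map σ conjugates) ≡⟨ ≡.cong vandermonde (LP.map-applyUpTo α σ d) ⟩
    vandermonde (applyUpTo (α ∘ suc) d) ≈⟨ vandermonde-rotate α d d≥1 α-period ⟩
    (- 1#) ^ (d ℕ.∸ 1) * V ∎

  -- f′(αᵢ) = c·∏_{j≠i}(αᵢ − αⱼ), as f = c·∏ⱼ(x − αⱼ)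
  otherDiffs : Fin (length conjugates) → Pol
  otherDiffs i = prod (map (λ y → lookup conjugates i - y) (removeAt conjugates i))

  σⁱ-f′ : ∀ (i : Fin (length conjugates)) → iter (toℕ i) (deriv f) ≈ lc * otherDiffs i
  σⁱ-f′ i = begin
    iter (toℕ i) (deriv f) ≈⟨ iter-cong (toℕ i) (sym (evK-X (deriv f))) ⟩
    iter (toℕ i) (evK (deriv f) X) ≈⟨ iter-evK (toℕ i) (deriv f) X ⟩
    evK (deriv f) (α (toℕ i)) ≡⟨ ≡.cong (evK (deriv f)) (≡.sym (LP.lookup-applyUpTo α d i)) ⟩
    evK (deriv f) (lookup conjugates i) ≈⟨ evK-deriv≈hornerDeriv f d (lookup conjugates i) (proj₂ hd) ⟩
    hornerDeriv fVec (lookup conjugates i)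
      ≈⟨ deriv-at-ith-root d fVec conjugates (LP.length-applyUpTo α d) conjugates-Distinct (roots-fVec d) i ⟩
    leading fVec * otherDiffs i ≡⟨ ≡.cong (_* otherDiffs i) leading-fVec ⟩
    lc * otherDiffs i ∎

  norm-f′ : norm (deriv f) ≈ lc ^ d * ((- 1#) ^ pairs d * (V * V))
  norm-f′ = begin
    norm (deriv f) ≡⟨ ≡.cong prod (≡.sym (tabulate-applyUpTo α (λ i → iter i (deriv f)) d)) ⟩
    prod (tabulate {n = length conjugates} (λ i → iter (toℕ i) (deriv f)))
      ≈⟨ prod-tab-cong (λ i → iter (toℕ i) (deriv f)) (λ i → lc * otherDiffs i) σⁱ-f′ ⟩
    prod (tabulate (λ i → lc * otherDiffs i)) ≈⟨ prod-tab-* (λ _ → lc) otherDiffs ⟩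
    prod (tabulate {n = length conjugates} (λ _ → lc)) * rootDiffProduct conjugates
      ≈⟨ *-cong (prod-const (length conjugates) lc) (rootDiffProduct≈vandermonde² conjugates) ⟩
    lc ^ length conjugates * ((- 1#) ^ pairs (length conjugates) * (V * V))
      ≡⟨ ≡.cong (λ l → lc ^ l * ((- 1#) ^ pairs l * (V * V))) (LP.length-applyUpTo α d) ⟩
    lc ^ d * ((- 1#) ^ pairs d * (V * V)) ∎

  1≈-1⇒2≈0 : 1# ≈ - 1# → FiniteField._+_ F (FiniteField.1# F) (FiniteField.1# F) ≈F 0F
  1≈-1⇒2≈0 e = const≈0 _ (trans (+-congʳ {1#} e) (-‿inverseˡ 1#))

  m1² : (- 1#) ^ 2 ≈ 1#
  m1² = solve 0 (:- con (+ 1) :* (:- con (+ 1) :* con (+ 1)) := con (+ 1)) refl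

  even-pow : ∀ x t → x ^ 2 ≈ 1# → x ^ (2 ℕ.* t) ≈ 1#
  even-pow x t e = trans (sym (^-assocʳ x 2 t)) (trans (^-congˡ t e) (one^ t))

  module OneModFour (u : ℕ) (q∸1≡u*4 : q ℕ.∸ 1 ≡ u ℕ.* 4) where
    open import Data.Nat.Solver using (module +-*-Solver)
    open +-*-Solver using () renaming (solve to solveℕ; _:=_ to _:=ℕ_; _:*_ to _:*ℕ_; _:+_ to _:+ℕ_; con to conℕ)

    q≡1+4u : q ≡ suc (u ℕ.* 4)
    q≡1+4u = ≡.trans (≡.sym (ℕP.m+[n∸m]≡n (ℕP.<⇒≤ q≥2))) (≡.cong suc q∸1≡u*4)

    q-odd : q ≡ suc ((u ℕ.* 2) ℕ.* 2)
    q-odd = ≡.trans q≡1+4u (≡.cong suc (≡.sym (ℕP.*-assoc u 2 2)))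

    fixed⇒pow≈1 : ∀ x → ¬ (x ≈ 0#) → σ x ≈ x → x ^ (u ℕ.* 4) ≈ 1#
    fixed⇒pow≈1 x x≉0 e = cancel x _ _ x≉0 (trans (≡.subst (λ m → x ^ m ≈ x) q≡1+4u e) (sym (*-identityʳ x)))

    sq-pow : ∀ x → (x * x) ^ (u ℕ.* 2) ≈ x ^ (u ℕ.* 4)
    sq-pow x = trans (^-distrib-* x x (u ℕ.* 2)) (trans (sym (^-homo-* x (u ℕ.* 2) (u ℕ.* 2)))
                 (≡.subst (λ m → x ^ (u ℕ.* 2 ℕ.+ u ℕ.* 2) ≈ x ^ m) (solveℕ 1 (λ u → u :*ℕ conℕ 2 :+ℕ u :*ℕ conℕ 2 :=ℕ u :*ℕ conℕ 4) ≡.refl u) refl))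

    -- if f′ ≡ s², then N(f′)^(2u) = (N(s)²)^(2u) = N(s)^(4u) = 1
    norm-square-power : ∀ s → s * s ≈ deriv f → norm (deriv f) ^ (u ℕ.* 2) ≈ 1#
    norm-square-power s s²≈f′ = begin
      norm (deriv f) ^ (u ℕ.* 2) ≈⟨ ^-congˡ (u ℕ.* 2) (trans (norm-cong (sym s²≈f′)) (norm-* s s)) ⟩
      (norm s * norm s) ^ (u ℕ.* 2) ≈⟨ sq-pow (norm s) ⟩
      norm s ^ (u ℕ.* 4) ≈⟨ fixed⇒pow≈1 (norm s) Ns≉0 (σ-norm s) ⟩
      1# ∎
      where
      Nf′≉0 : ¬ (norm (deriv f) ≈ 0#)
      Nf′≉0 e = mul≉0 (lc ^ d) _ (pow≉0 lc d lc≉0K) (mul≉0 _ _ (pow≉0 (- 1#) (pairs d) -1≉0) (mul≉0 V V V≉0 V≉0))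
                  (trans (sym norm-f′) e)
        where
        V≉0 = vandermonde≉0 conjugates conjugates-Distinct
        -1≉0 : ¬ (- 1# ≈ 0#)
        -1≉0 e = K1≉0 (trans (sym (-‿involutive 1#)) (trans (-‿cong e) -0#≈0#))
      Ns≉0 : ¬ (norm s ≈ 0#)
      Ns≉0 e = Nf′≉0 (trans (norm-cong (sym s²≈f′)) (trans (norm-* s s) (trans (*-cong e e) (zeroˡ 0#))))

    -- for d = 2m, V^(4u) = −1 since V·V^(4u) = σ(V) = (−1)^(d−1)·V = −V and V ≉ 0
    vandermonde-power : ∀ m → d ≡ 2 ℕ.* m → V ^ (u ℕ.* 4) ≈ - 1#
    vandermonde-power m d≡2m = cancel V _ _ (vandermonde≉0 conjugates conjugates-Distinct) (begin
      V * V ^ (u ℕ.* 4) ≡⟨ ≡.cong (V ^_) (≡.sym q≡1+4u) ⟩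
      σ V ≈⟨ σ-V ⟩
      (- 1#) ^ (d ℕ.∸ 1) * V ≈⟨ *-congʳ odd-sign ⟩
      - 1# * V ≈⟨ *-comm (- 1#) V ⟩
      V * - 1# ∎)
      where
      d∸1≡1+2t : d ℕ.∸ 1 ≡ suc (2 ℕ.* ℕ.pred m)
      d∸1≡1+2t = ≡.trans (≡.cong (ℕ._∸ 1) d≡2m) (odd m (≡.subst (1 ℕ.≤_) d≡2m d≥1))
        where
        odd : ∀ m → 1 ℕ.≤ 2 ℕ.* m → 2 ℕ.* m ℕ.∸ 1 ≡ suc (2 ℕ.* ℕ.pred m)
        odd (suc t) _ = ℕP.+-suc t (t ℕ.+ 0)
      odd-sign : (- 1#) ^ (d ℕ.∸ 1) ≈ - 1#
      odd-sign = ≡.subst (λ n → (- 1#) ^ n ≈ - 1#) (≡.sym d∸1≡1+2t)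
        (trans (*-congˡ { - 1#} (even-pow (- 1#) (ℕ.pred m) m1²)) (*-identityʳ _))

    -- for d = 2m, N(f′)^(2u) = (c^(4u))^m · ((−1)^(d(d−1)/2))^(2u) · V^(4u) = 1·1·(−1)
    norm-deriv-power : ∀ m → d ≡ 2 ℕ.* m → norm (deriv f) ^ (u ℕ.* 2) ≈ - 1#
    norm-deriv-power m d≡2m = begin
      norm (deriv f) ^ (u ℕ.* 2) ≈⟨ ^-congˡ (u ℕ.* 2) norm-f′ ⟩
      (lc ^ d * ((- 1#) ^ pairs d * (V * V))) ^ (u ℕ.* 2) ≈⟨ ^-distrib-* (lc ^ d) _ (u ℕ.* 2) ⟩
      (lc ^ d) ^ (u ℕ.* 2) * ((- 1#) ^ pairs d * (V * V)) ^ (u ℕ.* 2) ≈⟨ *-cong lc-part (^-distrib-* _ _ (u ℕ.* 2)) ⟩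
      1# * (((- 1#) ^ pairs d) ^ (u ℕ.* 2) * (V * V) ^ (u ℕ.* 2)) ≈⟨ *-congˡ {1#} (*-cong sign-part (trans (sq-pow V) (vandermonde-power m d≡2m))) ⟩
      1# * (1# * - 1#) ≈⟨ solve 0 (con (+ 1) :* (con (+ 1) :* (:- con (+ 1))) := :- con (+ 1)) refl ⟩
      - 1# ∎
      where
      lc-part : (lc ^ d) ^ (u ℕ.* 2) ≈ 1#
      lc-part = begin
        (lc ^ d) ^ (u ℕ.* 2) ≈⟨ ^-assocʳ lc d (u ℕ.* 2) ⟩
        lc ^ (d ℕ.* (u ℕ.* 2)) ≡⟨ ≡.cong (lc ^_) (≡.trans (≡.cong (λ z → z ℕ.* (u ℕ.* 2)) d≡2m)
                                  (solveℕ 2 (λ m u → (conℕ 2 :*ℕ m) :*ℕ (u :*ℕ conℕ 2) :=ℕ (u :*ℕ conℕ 4) :*ℕ m) ≡.refl m u)) ⟩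
        lc ^ ((u ℕ.* 4) ℕ.* m) ≈⟨ sym (^-assocʳ lc (u ℕ.* 4) m) ⟩
        (lc ^ (u ℕ.* 4)) ^ m ≈⟨ ^-congˡ m (fixed⇒pow≈1 lc lc≉0K (σ-const (coeff f d))) ⟩
        1# ^ m ≈⟨ one^ m ⟩
        1# ∎
      sign-part : ((- 1#) ^ pairs d) ^ (u ℕ.* 2) ≈ 1#
      sign-part = trans (^-assocʳ (- 1#) (pairs d) (u ℕ.* 2))
        (≡.subst (λ m → (- 1#) ^ m ≈ 1#) (solveℕ 2 (λ e u → conℕ 2 :*ℕ (e :*ℕ u) :=ℕ e :*ℕ (u :*ℕ conℕ 2)) ≡.refl (pairs d) u)
          (even-pow (- 1#) (pairs d ℕ.* u) m1²))


open import Level using (Level)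
open import Data.Nat using (_∸_; _*_)
open import Data.Nat.Divisibility using (_∣_; divides)
open import Data.Product using (Σ; _,_)
open import Relation.Binary.PropositionalEquality using (_≡_)

lemma5p1 : {c ℓ : Level} (q : ℕ) → IsPrimePower q → 4 ∣ (q ∸ 1)
    → (F : FiniteField c ℓ q) → let open Poly F in
    (f : Pol) (d : ℕ) → Irreducible f → HasDegree f d → (Σ ℕ λ m → d ≡ 2 * m)
    → QuadNonresidueMod f (deriv f)
lemma5p1 q ppow (divides u q∸1≡u*4) F f d irr hd (m , d≡2m) (s , h , s²-f′≈h*f) =
  odd⇒2≉0 (u * 2) q-odd (1≈-1⇒2≈0 1≈-1)
  where
  open FiniteFieldTheory F using (odd⇒2≉0)
  open ResidueRing F f d hd irr using (K; kq)
  open CommutativeRing K using (_≈_; 1#; -_; sym; trans) renaming (_*_ to _*K_)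
  open Conjugates q ppow F f d irr hd using (1≈-1⇒2≈0; module OneModFour)
  open OneModFour u q∸1≡u*4 using (q-odd; norm-square-power; norm-deriv-power)

  s²≈f′ : s *K s ≈ Poly.deriv F f
  s²≈f′ = kq (h , PolynomialRing.pw s²-f′≈h*f)

  1≈-1 : 1# ≈ - 1#
  1≈-1 = trans (sym (norm-square-power s s²≈f′)) (norm-deriv-power m d≡2m)
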